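{- Let $r<s\le N/2$ be positive integers and let $\mathbf c_i^{(\ell)}$ ($1\le i\le N$) be the $\mathbf c$-vectors of the Gale–Robinson quiver with principal coefficients after $\ell$ periodic mutations. For $\ell\ge r$ and $1\le i\le N$, with $\underline{i}=\lfloor (\ell+r-i)/N\rfloor N+i$, $$\mathbf c_i^{(\ell)}=\begin{cases}-E_{\underline i} & \text{if } \ell+1-r\le \underline i\le \ell,\\ E_{\underline i} & \text{if } \ell+1\le \underline i\le \ell+r,\\ F_{\underline i} & \text{otherwise.}\end{cases}$$
   Context: Gale–Robinson quiver $Q_N^{(r,s)}$ on vertices $1,\dots,N$: (1) arrows $i\to i+r$ for $1\le i\le N-r$ and $j\to N-r+j$ for $1\le j\le r$; (2) arrows $s+i\to i$ for $1\le i\le N-s$ and $N-s+j\to j$ for $1\le j\le s$; (3) arrows $r+i\to s+i$ for $1\le i\le N-r-s$ and $r+j\to N-s+j$ for $1\le j\le s-r$; (4) erase all 2-cycles. Its principal-coefficient extension $\widehat Q$ adds frozen vertices $N+1,\dots,2N$ and arrows $N+j\to j$. Quiver mutation at $k$: for every path $i\to k\to j$ add $i\to j$, reverse arrows at $k$, remove 2-cycles. Periodic mutation: the $m$-th mutation is at vertex $((m-1)\bmod N)+1$. For the quiver obtained after $\ell$ such mutations, $\mathbf c_i^{(\ell)}\in\mathbb{Z}^N$ has $j$-th entry equal to (number of arrows $N+j\to i$) minus (number of arrows $i\to N+j$); so $\mathbf c_i^{(0)}=\mathbf e_i$. For integers $m,a,b$, $d(m,a,b)$ is the number of pairs of nonnegative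 integers $(A,B)$ with $m=Aa+Bb$. $E_m=\sum_{j=1}^N d(m-j,r,N-r)\,\mathbf e_j$ and $F_m=\sum_{j=1}^N \chi(j\equiv m+N \bmod N-r)\,\mathbf e_j$, where $\chi$ is 1 if the condition holds and 0 otherwise. -}

module Defs where

open import Data.Bool using (Bool; true; false; if_then_else_; _∧_; _∨_)
open import Data.Nat as ℕ using (ℕ; zero; suc; _∸_; _≡ᵇ_; _≤ᵇ_; NonZero)
open import Data.Nat.DivMod using (_%_)
open import Data.Integer as ℤ using (ℤ; +_; -[1+_]; _-_; -_; _⊔_; _/ℕ_)
open import Data.Integer.Divisibility.Signed using (_∣?_)
open import Relation.Nullary using (does)

ind : Bool → ℕ
ind true  = 1
ind false = 0

sum1 : ℕ → (ℕ → ℕ) → ℕ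
sum1 zero    f = 0
sum1 (suc n) f = sum1 n f ℕ.+ f (suc n)

sum0 : ℕ → (ℕ → ℕ) → ℕ
sum0 n f = f 0 ℕ.+ sum1 n f

-- Quivers without 2-cycles on vertices 1,2,... encoded by their
-- skew-symmetric exchange matrix:  B i j = #(arrows i→j) − #(arrows j→i).

Mat : Set
Mat = ℕ → ℕ → ℤ

-- number of arrows i → j of Q_N^{(r,s)} produced by rules (1),(2),(3)
-- (before erasing 2-cycles); vertices 1..N
grArrows : ℕ → ℕ → ℕ → ℕ → ℕ → ℕ
grArrows N r s i j = sum1 N λ t →
    -- (1) t → t+r  (1 ≤ t ≤ N−r),   t → N−r+t  (1 ≤ t ≤ r)
    ind ((t ≤ᵇ N ∸ r) ∧ (i ≡ᵇ t) ∧ (j ≡ᵇ t ℕ.+ r))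
  ℕ.+ ind ((t ≤ᵇ r) ∧ (i ≡ᵇ t) ∧ (j ≡ᵇ (N ∸ r) ℕ.+ t))
    -- (2) s+t → t  (1 ≤ t ≤ N−s),   N−s+t → t  (1 ≤ t ≤ s)
  ℕ.+ ind ((t ≤ᵇ N ∸ s) ∧ (i ≡ᵇ s ℕ.+ t) ∧ (j ≡ᵇ t))
  ℕ.+ ind ((t ≤ᵇ s) ∧ (i ≡ᵇ (N ∸ s) ℕ.+ t) ∧ (j ≡ᵇ t))
    -- (3) r+t → s+t  (1 ≤ t ≤ N−r−s),   r+t → N−s+t  (1 ≤ t ≤ s−r)
  ℕ.+ ind ((t ≤ᵇ N ∸ r ∸ s) ∧ (i ≡ᵇ r ℕ.+ t) ∧ (j ≡ᵇ s ℕ.+ t))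
  ℕ.+ ind ((t ≤ᵇ s ∸ r) ∧ (i ≡ᵇ r ℕ.+ t) ∧ (j ≡ᵇ (N ∸ s) ℕ.+ t))

-- frozen arrows N+t → t of the principal extension (1 ≤ t ≤ N)
frozenArrows : ℕ → ℕ → ℕ → ℕ
frozenArrows N i j = sum1 N λ t → ind ((i ≡ᵇ N ℕ.+ t) ∧ (j ≡ᵇ t))

allArrows : ℕ → ℕ → ℕ → ℕ → ℕ → ℕ
allArrows N r s i j = grArrows N r s i j ℕ.+ frozenArrows N i j

-- exchange matrix of \hat Q (step (4): 2-cycles cancel in the net count)
initB : ℕ → ℕ → ℕ → Mat
initB N r s i j = + allArrows N r s i j - + allArrows N r s j i

pos : ℤ → ℤ
pos x = x ⊔ + 0

mutate : ℕ → Mat → Mat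
mutate k B i j =
  if (i ≡ᵇ k) ∨ (j ≡ᵇ k)
  then - B i j
  else B i j ℤ.+ pos (B i k) ℤ.* pos (B k j) - pos (B j k) ℤ.* pos (B k i)

periodicB : (N r s : ℕ) .{{_ : NonZero N}} → ℕ → Mat
periodicB N r s zero    = initB N r s
periodicB N r s (suc m) = mutate ((m % N) ℕ.+ 1) (periodicB N r s m)

-- j-th entry of c_i^{(ℓ)} : #(N+j → i) − #(i → N+j)
cvec : (N r s : ℕ) .{{_ : NonZero N}} → ℕ → ℕ → ℕ → ℤ
cvec N r s ℓ i j = periodicB N r s ℓ (N ℕ.+ j) i

-- d(m,a,b) = #{(A,B) ∈ ℕ² | m = A a + B b}.
-- Zero for m < 0; for m ≥ 0 and a,b ≥ 1 every solution has A,B ≤ m,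
-- so we count over 0 ≤ A,B ≤ m (only used with a,b ≥ 1).
d : ℤ → ℕ → ℕ → ℕ
d -[1+ _ ] a b = 0
d (+ m)    a b = sum0 m λ A → sum0 m λ B → ind ((A ℕ.* a ℕ.+ B ℕ.* b) ≡ᵇ m)

E : ℕ → ℕ → ℤ → ℕ → ℤ
E N r m j = + d (m - + j) r (N ∸ r)

F : ℕ → ℕ → ℤ → ℕ → ℤ
F N r m j = if does (+ (N ∸ r) ∣? (+ j - (m ℤ.+ + N))) then + 1 else + 0

under : (N r : ℕ) .{{_ : NonZero N}} → ℕ → ℕ → ℤ
under N r ℓ i = ((+ (ℓ ℕ.+ r) - + i) /ℕ N) ℤ.* + N ℤ.+ + i

-- Relabel a vertex i after ℓ periodic mutations by its position p ≡ i − ℓ (mod N), 1 ≤ p ≤ N. The vertex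
-- mutated next always sits at position 1, and mutating Q_N^{(r,s)} at 1 and then moving every position down
-- by one gives back Q_N^{(r,s)}: rules (1) and (2) are translation invariant, and the guard of rule (3) moves
-- only at i = r and j = N − r, exactly where the mutation creates and deletes arrows. So in these coordinates
-- the mutable part of the quiver never changes. The c-vector of the vertex being mutated is E_{ℓ+1} ≥ 0, hence
-- every other c-vector just gains E_{ℓ+1} once for each arrow from position 1 (to positions r + 1 and N − r + 1).
-- Induction on ℓ then shows that for ℓ ≥ r the c-vector of the vertex at position p is E_{ℓ+p} if p ≤ r,
-- F_{ℓ+p−N} if r < p ≤ N − r and −E_{ℓ+p−N} if p > N − r; the steps across the zone boundaries are the
-- recurrence d(m + r, r, N − r) = [N − r ∣ m + r] + d(m, r, N − r) and the (N − r)-periodicity of F.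
-- Finally ⌊(ℓ + r − i)/N⌋N + i equals ℓ + p when p ≤ r and ℓ + p − N otherwise.

module Submission where

open import Defs
open import Data.Bool using (Bool; true; false; T; if_then_else_; _∧_; _∨_)
open import Data.Bool.Properties using (T-∧)
open import Data.Empty using (⊥; ⊥-elim)
open import Data.Integer as ℤ using (ℤ; +_; -[1+_]; -_)
open import Data.Integer.DivMod using ([n/ℕd]*d≤n; n<s[n/ℕd]*d)
import Data.Integer.Properties as ℤP
open import Data.Integer.Tactic.RingSolver using (solve-∀)
open import Data.Nat as ℕ using (ℕ; zero; suc; NonZero; _≤_; _<_; _*_; _∸_; _≡ᵇ_; _≤ᵇ_; _<ᵇ_; z≤n; s≤s)
import Data.Integer.Divisibility.Signed as ℤ∣
open import Data.Nat.Divisibility using (_∣_; _∣?_; divides; ∣⇒≤; ∣m+n∣m⇒∣n; ∣m∣n⇒∣m+n; ∣-refl)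
open import Data.Nat.DivMod using (_%_; _/_; m%n<n; m≡m%n+[m/n]*n; m<n⇒m%n≡m; [m+kn]%n≡m%n)
import Data.Nat.Properties as ℕP
open import Data.Nat.Tactic.RingSolver using () renaming (solve-∀ to ℕ-solve)
open import Data.Product using (_×_; _,_; proj₁; proj₂; ∃-syntax)
open import Data.Sum using (_⊎_; inj₁; inj₂; [_,_]′; swap)
open import Data.Unit using (tt)
open import Function using (_∘_)
open import Function.Bundles using (Equivalence; mk⇔)
open import Relation.Binary.Definitions using (tri<; tri≈; tri>)
open import Relation.Binary.PropositionalEquality
open import Relation.Nullary using (¬_; does; yes; no; Dec)
open import Relation.Nullary.Decidable using (dec-true; dec-false; does-⇔)
open import Algebra.Properties.CommutativeSemigroup ℕP.+-commutativeSemigroup using () renaming (interchange to +-interchange)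

T-ext : ∀ {a b} → (T a → T b) → (T b → T a) → a ≡ b
T-ext {false} {false} _ _ = refl
T-ext {false} {true}  _ g = ⊥-elim (g tt)
T-ext {true}  {false} f _ = ⊥-elim (f tt)
T-ext {true}  {true}  _ _ = refl

both-true : ∀ {a b} → T a → T b → a ≡ b
both-true ta tb = T-ext (λ _ → tb) (λ _ → ta)

both-false : ∀ {a b} → ¬ T a → ¬ T b → a ≡ b
both-false ¬a ¬b = T-ext (⊥-elim ∘ ¬a) (⊥-elim ∘ ¬b)

ind-false : ∀ {b} → ¬ T b → ind b ≡ 0
ind-false {false} _  = refl
ind-false {true}  ¬b = ⊥-elim (¬b tt)

ind-true : ∀ {b} → T b → ind b ≡ 1
ind-true {true} _ = refl

ind-cong : ∀ {a b} → (T a → T b) → (T b → T a) → ind a ≡ ind b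
ind-cong f g = cong ind (T-ext f g)

ind-≢ : ∀ {x y} → x ≢ y → ind (x ≡ᵇ y) ≡ 0
ind-≢ {x} {y} x≢y = ind-false (λ h → x≢y (ℕP.≡ᵇ⇒≡ x y h))

ind-≡ : ∀ {x y} → x ≡ y → ind (x ≡ᵇ y) ≡ 1
ind-≡ {x} {y} x≡y = ind-true (ℕP.≡⇒≡ᵇ x y x≡y)

ind-refl : ∀ x → ind (x ≡ᵇ x) ≡ 1
ind-refl x = ind-≡ {x} refl

ind-sym : ∀ x y → ind (x ≡ᵇ y) ≡ ind (y ≡ᵇ x)
ind-sym x y = ind-cong (λ h → ℕP.≡⇒≡ᵇ y x (sym (ℕP.≡ᵇ⇒≡ x y h))) (λ h → ℕP.≡⇒≡ᵇ x y (sym (ℕP.≡ᵇ⇒≡ y x h)))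

ind-∸-zero : ∀ {i j} → j ≤ i → ind (i ∸ j ≡ᵇ 0) ≡ ind (i ≡ᵇ j)
ind-∸-zero {i} {j} j≤i = ind-cong
  (λ h → ℕP.≡⇒≡ᵇ i j (ℕP.≤-antisym (ℕP.m∸n≡0⇒m≤n (ℕP.≡ᵇ⇒≡ _ 0 h)) j≤i))
  (λ h → ℕP.≡⇒≡ᵇ _ 0 (trans (cong (_∸ j) (ℕP.≡ᵇ⇒≡ i j h)) (ℕP.n∸n≡0 j)))

ind-≡ᵇ-∸ : ∀ {n x y} → y ≤ n → ind (n ≡ᵇ x ℕ.+ y) ≡ ind (x ≡ᵇ n ∸ y)
ind-≡ᵇ-∸ {n} {x} {y} y≤n = ind-cong
  (λ h → ℕP.≡⇒≡ᵇ x _ (trans (sym (ℕP.m+n∸n≡m x y)) (cong (_∸ y) (sym (ℕP.≡ᵇ⇒≡ n _ h)))))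
  (λ h → ℕP.≡⇒≡ᵇ n _ (trans (sym (ℕP.m∸n+n≡m y≤n)) (cong (ℕ._+ y) (sym (ℕP.≡ᵇ⇒≡ x _ h)))))

ind-≡ᵇ-cancelʳ : ∀ a {c d e} → c ℕ.+ d ≡ e → ind (e ≡ᵇ a ℕ.+ d) ≡ ind (a ≡ᵇ c)
ind-≡ᵇ-cancelʳ a {c} {d} {e} c+d≡e = ind-cong
  (λ h → ℕP.≡⇒≡ᵇ a c (ℕP.+-cancelʳ-≡ d a c (trans (sym (ℕP.≡ᵇ⇒≡ e _ h)) (sym c+d≡e))))
  (λ h → ℕP.≡⇒≡ᵇ e _ (trans (sym c+d≡e) (cong (ℕ._+ d) (sym (ℕP.≡ᵇ⇒≡ a c h)))))

ind-beyond : ∀ {n x} y → x < n → ind (x ≡ᵇ n ℕ.+ y) ≡ 0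
ind-beyond {n} {x} y x<n = ind-≢ λ x≡n+y → ℕP.<⇒≱ x<n (subst (n ≤_) (sym x≡n+y) (ℕP.m≤m+n n y))

ind-∧-implied : ∀ g e → (T e → T g) → ind (g ∧ e) ≡ ind e
ind-∧-implied g e e⇒g = ind-cong (proj₂ ∘ Equivalence.to (T-∧ {g})) (λ te → Equivalence.from (T-∧ {g}) (e⇒g te , te))

ind-∧-refuted : ∀ g e → ¬ T g → ind (g ∧ e) ≡ 0
ind-∧-refuted g e ¬g = ind-false (¬g ∘ proj₁ ∘ Equivalence.to (T-∧ {g}))

sum1-cong : ∀ n {f g : ℕ → ℕ} → (∀ t → f t ≡ g t) → sum1 n f ≡ sum1 n g
sum1-cong zero    f≗g = refl
sum1-cong (suc n) f≗g = cong₂ ℕ._+_ (sum1-cong n f≗g) (f≗g (suc n))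

sum1-+ : ∀ n (f g : ℕ → ℕ) → sum1 n (λ t → f t ℕ.+ g t) ≡ sum1 n f ℕ.+ sum1 n g
sum1-+ zero    f g = refl
sum1-+ (suc n) f g = begin
  sum1 n (λ t → f t ℕ.+ g t) ℕ.+ (f (suc n) ℕ.+ g (suc n))
    ≡⟨ cong (ℕ._+ (f (suc n) ℕ.+ g (suc n))) (sum1-+ n f g) ⟩
  sum1 n f ℕ.+ sum1 n g ℕ.+ (f (suc n) ℕ.+ g (suc n))
    ≡⟨ +-interchange (sum1 n f) (sum1 n g) (f (suc n)) (g (suc n)) ⟩
  sum1 n f ℕ.+ f (suc n) ℕ.+ (sum1 n g ℕ.+ g (suc n)) ∎
  where open ≡-Reasoning

sum1-+-cong : ∀ n {f g : ℕ → ℕ} {a b} → sum1 n f ≡ a → sum1 n g ≡ b → sum1 n (λ t → f t ℕ.+ g t) ≡ a ℕ.+ b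
sum1-+-cong n {f} {g} f≡a g≡b = trans (sum1-+ n f g) (cong₂ ℕ._+_ f≡a g≡b)

sum1-zero : ∀ n (f : ℕ → ℕ) → (∀ t → 1 ≤ t → t ≤ n → f t ≡ 0) → sum1 n f ≡ 0
sum1-zero zero    f f≡0 = refl
sum1-zero (suc n) f f≡0 =
  cong₂ ℕ._+_ (sum1-zero n f (λ t 1≤t t≤n → f≡0 t 1≤t (ℕP.m≤n⇒m≤1+n t≤n))) (f≡0 (suc n) (s≤s z≤n) ℕP.≤-refl)

sum1-single : ∀ n (f : ℕ → ℕ) t₀ → 1 ≤ t₀ → t₀ ≤ n → (∀ t → t ≢ t₀ → f t ≡ 0) → sum1 n f ≡ f t₀
sum1-single zero    f t₀ 1≤t₀ t₀≤0 _ with () ← ℕP.<-≤-trans 1≤t₀ t₀≤0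
sum1-single (suc n) f t₀ 1≤t₀ t₀≤1+n f≡0 with t₀ ℕP.≟ suc n
... | yes refl = cong (ℕ._+ f (suc n)) (sum1-zero n f (λ t _ t≤n → f≡0 t (ℕP.<⇒≢ (s≤s t≤n))))
... | no t₀≢1+n = begin
  sum1 n f ℕ.+ f (suc n) ≡⟨ cong₂ ℕ._+_ (sum1-single n f t₀ 1≤t₀ (ℕP.≤-pred (ℕP.≤∧≢⇒< t₀≤1+n t₀≢1+n)) f≡0)
                                         (f≡0 (suc n) (t₀≢1+n ∘ sym)) ⟩
  f t₀ ℕ.+ 0             ≡⟨ ℕP.+-identityʳ (f t₀) ⟩
  f t₀                   ∎
  where open ≡-Reasoning

sum1-suc : ∀ n (f : ℕ → ℕ) → sum1 (suc n) f ≡ sum0 n (λ t → f (suc t))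
sum1-suc zero    f = ℕP.+-comm 0 (f 1)
sum1-suc (suc n) f = trans (cong (ℕ._+ f (2 ℕ.+ n)) (sum1-suc n f))
                           (ℕP.+-assoc (f 1) (sum1 n (λ t → f (suc t))) (f (2 ℕ.+ n)))

sum1-truncate : ∀ m k (f : ℕ → ℕ) → (∀ t → m < t → f t ≡ 0) → sum1 (m ℕ.+ k) f ≡ sum1 m f
sum1-truncate m zero    f f≡0 = cong (λ n → sum1 n f) (ℕP.+-identityʳ m)
sum1-truncate m (suc k) f f≡0 = begin
  sum1 (m ℕ.+ suc k) f                   ≡⟨ cong (λ n → sum1 n f) (ℕP.+-suc m k) ⟩
  sum1 (m ℕ.+ k) f ℕ.+ f (suc (m ℕ.+ k)) ≡⟨ cong₂ ℕ._+_ (sum1-truncate m k f f≡0) (f≡0 _ (s≤s (ℕP.m≤m+n m k))) ⟩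
  sum1 m f ℕ.+ 0                         ≡⟨ ℕP.+-identityʳ (sum1 m f) ⟩
  sum1 m f                               ∎
  where open ≡-Reasoning

sum0-cong : ∀ n {f g : ℕ → ℕ} → (∀ t → f t ≡ g t) → sum0 n f ≡ sum0 n g
sum0-cong n f≗g = cong₂ ℕ._+_ (f≗g 0) (sum1-cong n f≗g)

sum0-zero : ∀ n (f : ℕ → ℕ) → (∀ t → t ≤ n → f t ≡ 0) → sum0 n f ≡ 0
sum0-zero n f f≡0 = cong₂ ℕ._+_ (f≡0 0 z≤n) (sum1-zero n f (λ t _ → f≡0 t))

sum0-single : ∀ n (f : ℕ → ℕ) t₀ → t₀ ≤ n → (∀ t → t ≢ t₀ → f t ≡ 0) → sum0 n f ≡ f t₀
sum0-single n f zero     _      f≡0 =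
  trans (cong (f 0 ℕ.+_) (sum1-zero n f (λ { (suc t) _ _ → f≡0 (suc t) λ () }))) (ℕP.+-identityʳ (f 0))
sum0-single n f (suc t₀) t₀≤n f≡0 = cong₂ ℕ._+_ (f≡0 0 λ ()) (sum1-single n f (suc t₀) (s≤s z≤n) t₀≤n f≡0)

sum0-truncate : ∀ m k (f : ℕ → ℕ) → (∀ t → m < t → f t ≡ 0) → sum0 (m ℕ.+ k) f ≡ sum0 m f
sum0-truncate m k f f≡0 = cong (f 0 ℕ.+_) (sum1-truncate m k f f≡0)

rule-count : ∀ n (g : ℕ → Bool) (f h : ℕ → ℕ) {x y} t₀ (P : Bool) → 1 ≤ t₀ → t₀ ≤ n →
             (∀ t → x ≡ f t → y ≡ h t → t ≡ t₀) →
             (T (g t₀) → x ≡ f t₀ → y ≡ h t₀ → T P) → (T P → T (g t₀) × x ≡ f t₀ × y ≡ h t₀) →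
             sum1 n (λ t → ind (g t ∧ (x ≡ᵇ f t) ∧ (y ≡ᵇ h t))) ≡ ind P
rule-count n g f h {x} {y} t₀ P 1≤t₀ t₀≤n unique to from = begin
  sum1 n (λ t → ind (rule t)) ≡⟨ sum1-single n _ t₀ 1≤t₀ t₀≤n (λ t t≢t₀ → ind-false λ ht → t≢t₀ (unique′ t ht)) ⟩
  ind (rule t₀)               ≡⟨ ind-cong (λ ht₀ → let gt , x≡ , y≡ = decode t₀ ht₀ in to gt x≡ y≡) encode ⟩
  ind P                       ∎
  where
  open ≡-Reasoning
  rule : ℕ → Bool
  rule t = g t ∧ (x ≡ᵇ f t) ∧ (y ≡ᵇ h t)
  decode : ∀ t → T (rule t) → T (g t) × x ≡ f t × y ≡ h t
  decode t ht = let gt , rest = Equivalence.to (T-∧ {g t}) ht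
                    x≡ , y≡ = Equivalence.to (T-∧ {x ≡ᵇ f t}) rest
                in gt , ℕP.≡ᵇ⇒≡ x (f t) x≡ , ℕP.≡ᵇ⇒≡ y (h t) y≡
  unique′ : ∀ t → T (rule t) → t ≡ t₀
  unique′ t ht = let _ , x≡ , y≡ = decode t ht in unique t x≡ y≡
  encode : T P → T (rule t₀)
  encode p = let gt , x≡ , y≡ = from p in
    Equivalence.from (T-∧ {g t₀}) (gt , Equivalence.from (T-∧ {x ≡ᵇ f t₀}) (ℕP.≡⇒≡ᵇ x (f t₀) x≡ , ℕP.≡⇒≡ᵇ y (h t₀) y≡))

rule-empty : ∀ n (g : ℕ → Bool) (f h : ℕ → ℕ) {x y} → (∀ t → 1 ≤ t → t ≤ n → T (g t) → x ≡ f t → y ≡ h t → ⊥) →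
             sum1 n (λ t → ind (g t ∧ (x ≡ᵇ f t) ∧ (y ≡ᵇ h t))) ≡ 0
rule-empty n g f h {x} {y} impossible = sum1-zero n _ λ t 1≤t t≤n → ind-false λ ht →
  let gt , rest = Equivalence.to (T-∧ {g t}) ht
      x≡ , y≡ = Equivalence.to (T-∧ {x ≡ᵇ f t}) rest
  in impossible t 1≤t t≤n gt (ℕP.≡ᵇ⇒≡ x (f t) x≡) (ℕP.≡ᵇ⇒≡ y (h t) y≡)

-- Counting representations m = A a + B b

≡ᵇ-+ˡ : ∀ a x y → (a ℕ.+ x ≡ᵇ a ℕ.+ y) ≡ (x ≡ᵇ y)
≡ᵇ-+ˡ zero    x y = refl
≡ᵇ-+ˡ (suc a) x y = ≡ᵇ-+ˡ a x y

d-multiples : ∀ b m .{{_ : NonZero b}} → sum0 m (λ B → ind (B * b ≡ᵇ m)) ≡ ind (does (b ∣? m))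
d-multiples b m with b ∣? m
... | yes (divides q m≡q*b) =
  trans (sum0-single m _ q (subst (q ≤_) (sym m≡q*b) (ℕP.m≤m*n q b))
                     (λ t t≢q → ind-≢ (λ t*b≡m → t≢q (ℕP.*-cancelʳ-≡ t q b (trans t*b≡m m≡q*b)))))
        (ind-≡ (sym m≡q*b))
... | no b∤m = sum0-zero m _ (λ B _ → ind-≢ (λ B*b≡m → b∤m (divides B (sym B*b≡m))))

d-below : ∀ a b y .{{_ : NonZero a}} .{{_ : NonZero b}} → y < a → d (+ y) a b ≡ ind (does (b ∣? y))
d-below a b y y<a = begin
  sum0 y (λ B → ind (B * b ≡ᵇ y)) ℕ.+ sum1 y _ ≡⟨ cong₂ ℕ._+_ (d-multiples b y) (sum1-zero y _ no-solution) ⟩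
  ind (does (b ∣? y)) ℕ.+ 0                   ≡⟨ ℕP.+-identityʳ _ ⟩
  ind (does (b ∣? y))                         ∎
  where
  open ≡-Reasoning
  no-solution : ∀ A → 1 ≤ A → A ≤ y → sum0 y (λ B → ind (A * a ℕ.+ B * b ≡ᵇ y)) ≡ 0
  no-solution (suc A) _ _ = sum0-zero y _ λ B _ → ind-≢ λ eq →
    ℕP.<⇒≱ y<a (ℕP.≤-trans (ℕP.m≤m+n a (A * a ℕ.+ B * b)) (ℕP.≤-reflexive (trans (sym (ℕP.+-assoc a _ _)) eq)))

-- solutions with A = 0 count the multiples of b, and A ↦ A − 1 maps the others onto the solutions for y
d-step : ∀ a b y .{{_ : NonZero a}} .{{_ : NonZero b}} →
         d (+ (a ℕ.+ y)) a b ≡ ind (does (b ∣? (a ℕ.+ y))) ℕ.+ d (+ y) a b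
d-step a@(suc a′) b y = cong₂ ℕ._+_ (d-multiples b (a ℕ.+ y)) (begin
  sum1 (a ℕ.+ y) (λ A → sols A (a ℕ.+ y) (a ℕ.+ y)) ≡⟨ sum1-suc (a′ ℕ.+ y) _ ⟩
  sum0 (a′ ℕ.+ y) (λ A → sols (suc A) (a ℕ.+ y) (a ℕ.+ y)) ≡⟨ sum0-cong (a′ ℕ.+ y) shift-A ⟩
  sum0 (a′ ℕ.+ y) (λ A → sols A y y)               ≡⟨ cong (λ n → sum0 n (λ A → sols A y y)) (ℕP.+-comm a′ y) ⟩
  sum0 (y ℕ.+ a′) (λ A → sols A y y)               ≡⟨ sum0-truncate y a′ _ (λ A y<A → sum0-zero y _ λ B _ →
                                                      ind-≢ (overshoots y<A (ℕP.≤-trans (ℕP.m≤m*n A a) (ℕP.m≤m+n (A * a) (B * b))))) ⟩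
  sum0 y (λ A → sols A y y)                        ∎)
  where
  open ≡-Reasoning
  sols : ℕ → ℕ → ℕ → ℕ
  sols A m k = sum0 k (λ B → ind (A * a ℕ.+ B * b ≡ᵇ m))
  overshoots : ∀ {u v} → y < u → u ≤ v → v ≢ y
  overshoots y<u u≤v v≡y = ℕP.<⇒≱ y<u (subst (_ ≤_) v≡y u≤v)
  shift-A : ∀ A → sols (suc A) (a ℕ.+ y) (a ℕ.+ y) ≡ sols A y y
  shift-A A = begin
    sols (suc A) (a ℕ.+ y) (a ℕ.+ y)                 ≡⟨ sum0-cong (a ℕ.+ y) (λ B →
      cong ind (trans (cong (_≡ᵇ a ℕ.+ y) (ℕP.+-assoc a (A * a) (B * b))) (≡ᵇ-+ˡ a _ y))) ⟩
    sum0 (a ℕ.+ y) (λ B → ind (A * a ℕ.+ B * b ≡ᵇ y)) ≡⟨ cong (λ n → sum0 n (λ B → ind (A * a ℕ.+ B * b ≡ᵇ y))) (ℕP.+-comm a y) ⟩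
    sum0 (y ℕ.+ a) (λ B → ind (A * a ℕ.+ B * b ≡ᵇ y)) ≡⟨ sum0-truncate y a _ (λ B y<B →
                                                          ind-≢ (overshoots y<B (ℕP.≤-trans (ℕP.m≤m*n B b) (ℕP.m≤n+m (B * b) (A * a))))) ⟩
    sols A y y                                       ∎

+-swap-outer : ∀ x y z → x ℕ.+ y ℕ.+ z ≡ z ℕ.+ y ℕ.+ x
+-swap-outer = ℕ-solve

residue-unique : ∀ n .{{_ : NonZero n}} {x y} Q Q′ → 1 ≤ x → x ≤ n → 1 ≤ y → y ≤ n → Q * n ℕ.+ x ≡ Q′ * n ℕ.+ y → x ≡ y
residue-unique n {suc x} {suc y} Q Q′ _ x<n _ y<n eq = cong suc (begin
  x                   ≡⟨ sym (m<n⇒m%n≡m x<n) ⟩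
  x % n               ≡⟨ sym ([m+kn]%n≡m%n x Q n) ⟩
  (x ℕ.+ Q * n) % n   ≡⟨ cong (_% n) (ℕP.suc-injective (trans (ℕP.+-comm (suc x) (Q * n)) (trans eq (ℕP.+-comm (Q′ * n) (suc y))))) ⟩
  (y ℕ.+ Q′ * n) % n  ≡⟨ [m+kn]%n≡m%n y Q′ n ⟩
  y % n               ≡⟨ m<n⇒m%n≡m y<n ⟩
  y                   ∎)
  where open ≡-Reasoning

/ℕ-unique : ∀ z Q n .{{_ : NonZero n}} → Q ℤ.* + n ℤ.≤ z → z ℤ.< ℤ.suc Q ℤ.* + n → z ℤ./ℕ n ≡ Q
/ℕ-unique z Q n Qn≤z z<[1+Q]n = ℤP.≤-antisym
  (≤-from-< (ℤP.≤-<-trans ([n/ℕd]*d≤n z n) z<[1+Q]n))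
  (≤-from-< (ℤP.≤-<-trans Qn≤z (n<s[n/ℕd]*d z n)))
  where
  ≤-from-< : ∀ {x y} → x ℤ.* + n ℤ.< ℤ.suc y ℤ.* + n → x ℤ.≤ y
  ≤-from-< {x} {y} lt = subst (x ℤ.≤_) (ℤP.pred-suc y) (ℤP.i<j⇒i≤pred[j] (ℤP.*-cancelʳ-<-nonNeg {x} {ℤ.suc y} (+ n) lt))

floor-window : ∀ n .{{_ : NonZero n}} (a i Q : ℤ) → a ℤ.- + n ℤ.< i ℤ.+ Q ℤ.* + n → i ℤ.+ Q ℤ.* + n ℤ.≤ a →
               ((a ℤ.- i) ℤ./ℕ n) ℤ.* + n ℤ.+ i ≡ i ℤ.+ Q ℤ.* + n
floor-window n a i Q lower upper = begin
  ((a ℤ.- i) ℤ./ℕ n) ℤ.* + n ℤ.+ i ≡⟨ cong (λ q → q ℤ.* + n ℤ.+ i) (/ℕ-unique (a ℤ.- i) Q n Qn≤a-i a-i<[1+Q]n) ⟩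
  Q ℤ.* + n ℤ.+ i                  ≡⟨ ℤP.+-comm (Q ℤ.* + n) i ⟩
  i ℤ.+ Q ℤ.* + n                  ∎
  where
  open ≡-Reasoning
  Qn≤a-i : Q ℤ.* + n ℤ.≤ a ℤ.- i
  Qn≤a-i = subst (ℤ._≤ a ℤ.- i) (cancel i (Q ℤ.* + n)) (ℤP.+-monoˡ-≤ (ℤ.- i) upper)
    where cancel : ∀ x y → x ℤ.+ y ℤ.- x ≡ y
          cancel = solve-∀
  a-i<[1+Q]n : a ℤ.- i ℤ.< ℤ.suc Q ℤ.* + n
  a-i<[1+Q]n = subst₂ ℤ._<_ (telescope a i (+ n)) (collect i Q (+ n)) (ℤP.+-monoˡ-< (+ n ℤ.- i) lower)
    where telescope : ∀ x y m → x ℤ.- m ℤ.+ (m ℤ.- y) ≡ x ℤ.- y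
          telescope = solve-∀
          collect : ∀ x q m → x ℤ.+ q ℤ.* m ℤ.+ (m ℤ.- x) ≡ (+ 1 ℤ.+ q) ℤ.* m
          collect = solve-∀

∸-below : ∀ {x c j} .{{_ : NonZero c}} → x ≤ c → 1 ≤ j → x ∸ j < c
∸-below {x} {c} {j} x≤c 1≤j = ℕP.m<n+o⇒m∸n<o x j (ℕP.≤-<-trans x≤c (subst (c <_) (ℕP.+-comm c j) (ℕP.m<m+n c 1≤j)))

pos<pos+1 : ∀ n → + n ℤ.< + n ℤ.+ + 1
pos<pos+1 n = subst (+ n ℤ.<_) (ℤP.pos-+ n 1) (ℤ.+<+ (ℕP.m<m+n n (s≤s z≤n)))

diff-≤ : ∀ {a b c d} → a ℕ.+ d ≤ c ℕ.+ b → + a ℤ.- + b ℤ.≤ + c ℤ.- + d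
diff-≤ {a} {b} {c} {d} a+d≤c+b =
  subst₂ ℤ._≤_ (cancel (+ a) (+ b) (+ d)) (cancel′ (+ c) (+ b) (+ d))
         (ℤP.+-monoˡ-≤ (ℤ.- (+ b ℤ.+ + d)) (subst₂ ℤ._≤_ (ℤP.pos-+ a d) (ℤP.pos-+ c b) (ℤ.+≤+ a+d≤c+b)))
  where
  cancel : ∀ x y z → x ℤ.+ z ℤ.+ ℤ.- (y ℤ.+ z) ≡ x ℤ.- y
  cancel = solve-∀
  cancel′ : ∀ x y z → x ℤ.+ y ℤ.+ ℤ.- (y ℤ.+ z) ≡ x ℤ.- z
  cancel′ = solve-∀

diff-< : ∀ {a b c d} → a ℕ.+ d < c ℕ.+ b → + a ℤ.- + b ℤ.< + c ℤ.- + d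
diff-< {a} {b} {c} {d} a+d<c+b =
  subst₂ ℤ._<_ (cancel (+ a) (+ b) (+ d)) (cancel′ (+ c) (+ b) (+ d))
         (ℤP.+-monoˡ-< (ℤ.- (+ b ℤ.+ + d)) (subst₂ ℤ._<_ (ℤP.pos-+ a d) (ℤP.pos-+ c b) (ℤ.+<+ a+d<c+b)))
  where
  cancel : ∀ x y z → x ℤ.+ z ℤ.+ ℤ.- (y ℤ.+ z) ≡ x ℤ.- y
  cancel = solve-∀
  cancel′ : ∀ x y z → x ℤ.+ y ℤ.+ ℤ.- (y ℤ.+ z) ≡ x ℤ.- z
  cancel′ = solve-∀

pos-balance : ∀ A B A′ B′ p q → A ℕ.+ p ℕ.+ B′ ≡ A′ ℕ.+ q ℕ.+ B → + A ℤ.- + B ℤ.+ + p ℤ.- + q ≡ + A′ ℤ.- + B′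
pos-balance A B A′ B′ p q balanced = begin
  + A ℤ.- + B ℤ.+ + p ℤ.- + q
    ≡⟨ regroup (+ A) (+ B) (+ p) (+ q) (+ A′) (+ B′) ⟩
  (+ A ℤ.+ + p ℤ.+ + B′) ℤ.- (+ A′ ℤ.+ + q ℤ.+ + B) ℤ.+ (+ A′ ℤ.- + B′)
    ≡⟨ cong (λ x → x ℤ.- (+ A′ ℤ.+ + q ℤ.+ + B) ℤ.+ (+ A′ ℤ.- + B′))
            (trans (sym (as-pos A p B′)) (trans (cong +_ balanced) (as-pos A′ q B))) ⟩
  (+ A′ ℤ.+ + q ℤ.+ + B) ℤ.- (+ A′ ℤ.+ + q ℤ.+ + B) ℤ.+ (+ A′ ℤ.- + B′)
    ≡⟨ cong (ℤ._+ (+ A′ ℤ.- + B′)) (ℤP.+-inverseʳ (+ A′ ℤ.+ + q ℤ.+ + B)) ⟩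
  + 0 ℤ.+ (+ A′ ℤ.- + B′)
    ≡⟨ ℤP.+-identityˡ _ ⟩
  + A′ ℤ.- + B′ ∎
  where
  open ≡-Reasoning
  regroup : ∀ a b p q a′ b′ → a ℤ.- b ℤ.+ p ℤ.- q ≡ (a ℤ.+ p ℤ.+ b′) ℤ.- (a′ ℤ.+ q ℤ.+ b) ℤ.+ (a′ ℤ.- b′)
  regroup = solve-∀
  as-pos : ∀ x y z → + (x ℕ.+ y ℕ.+ z) ≡ + x ℤ.+ + y ℤ.+ + z
  as-pos x y z = trans (ℤP.pos-+ (x ℕ.+ y) z) (cong (ℤ._+ + z) (ℤP.pos-+ x y))

pos-neg : ∀ n → pos (- + n) ≡ + 0
pos-neg zero    = refl
pos-neg (suc n) = refl

pos-diff : ∀ m n → m ≡ 0 ⊎ n ≡ 0 → pos (+ m ℤ.- + n) ≡ + m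
pos-diff .0 zero    (inj₁ refl) = refl
pos-diff .0 (suc n) (inj₁ refl) = refl
pos-diff m  .0      (inj₂ refl) = trans (cong pos (ℤP.+-identityʳ (+ m))) (ℤP.i≥j⇒i⊔j≡i (ℤ.+≤+ z≤n))

-- Quiver mutation

SkewSymmetric : Mat → Set
SkewSymmetric B = ∀ i j → B i j ≡ - B j i

mutate-skew : ∀ k (B : Mat) → SkewSymmetric B → SkewSymmetric (mutate k B)
mutate-skew k B skew i j with i ≡ᵇ k | j ≡ᵇ k
... | true  | true  = cong -_ (skew i j)
... | true  | false = cong -_ (skew i j)
... | false | true  = cong -_ (skew i j)
... | false | false = trans (cong (λ b → b ℤ.+ X ℤ.- Y) (skew i j)) (flip (B j i) X Y)
  where
  X Y : ℤ
  X = pos (B i k) ℤ.* pos (B k j)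
  Y = pos (B j k) ℤ.* pos (B k i)
  flip : ∀ b x y → - b ℤ.+ x ℤ.- y ≡ - (b ℤ.+ y ℤ.- x)
  flip = solve-∀

periodicB-skew : ∀ N r s .{{_ : NonZero N}} ℓ → SkewSymmetric (periodicB N r s ℓ)
periodicB-skew N r s zero    i j = diff-skew (+ allArrows N r s i j) (+ allArrows N r s j i)
  where diff-skew : ∀ a b → a ℤ.- b ≡ - (b ℤ.- a)
        diff-skew = solve-∀
periodicB-skew N r s (suc ℓ) = mutate-skew _ _ (periodicB-skew N r s ℓ)

mutate-relabel : ∀ (P : ℕ → Set) (σ : ℕ → ℕ) (B B′ : Mat) {k i j} → P k → P i → P j →
                 (∀ {x} → P x → (x ≡ᵇ k) ≡ (σ x ≡ᵇ σ k)) → (∀ {x y} → P x → P y → B x y ≡ B′ (σ x) (σ y)) →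
                 mutate k B i j ≡ mutate (σ k) B′ (σ i) (σ j)
mutate-relabel P σ B B′ Pk Pi Pj same-k same-B
  rewrite same-k Pi | same-k Pj | same-B Pi Pj | same-B Pi Pk | same-B Pk Pj | same-B Pj Pk | same-B Pk Pi = refl

c-mutation : ∀ k (B : Mat) {x} i n → SkewSymmetric B → x ≢ k → B x k ≡ + n →
             mutate k B x i ≡ (if i ≡ᵇ k then - B x i else B x i ℤ.+ + n ℤ.* pos (B k i))
c-mutation k B {x} i n skew x≢k Bxk≡n = begin
  (if (x ≡ᵇ k) ∨ (i ≡ᵇ k) then - B x i else B x i ℤ.+ pos (B x k) ℤ.* pos (B k i) ℤ.- pos (B i k) ℤ.* pos (B k x))
    ≡⟨ cong (λ b → if b ∨ (i ≡ᵇ k) then - B x i else B x i ℤ.+ pos (B x k) ℤ.* pos (B k i) ℤ.- pos (B i k) ℤ.* pos (B k x))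
            (dec-false (x ℕP.≟ k) x≢k) ⟩
  (if i ≡ᵇ k then - B x i else B x i ℤ.+ pos (B x k) ℤ.* pos (B k i) ℤ.- pos (B i k) ℤ.* pos (B k x))
    ≡⟨ cong (λ e → if i ≡ᵇ k then - B x i else e) gain ⟩
  (if i ≡ᵇ k then - B x i else B x i ℤ.+ + n ℤ.* pos (B k i)) ∎
  where
  open ≡-Reasoning
  pos-Bkx : pos (B k x) ≡ + 0
  pos-Bkx = trans (cong pos (trans (skew k x) (cong -_ Bxk≡n))) (pos-neg n)
  gain : B x i ℤ.+ pos (B x k) ℤ.* pos (B k i) ℤ.- pos (B i k) ℤ.* pos (B k x) ≡ B x i ℤ.+ + n ℤ.* pos (B k i)
  gain = begin
    B x i ℤ.+ pos (B x k) ℤ.* pos (B k i) ℤ.- pos (B i k) ℤ.* pos (B k x)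
      ≡⟨ cong₂ (λ a b → B x i ℤ.+ a ℤ.* pos (B k i) ℤ.- pos (B i k) ℤ.* b)
               (trans (cong pos Bxk≡n) (ℤP.i≥j⇒i⊔j≡i (ℤ.+≤+ z≤n))) pos-Bkx ⟩
    B x i ℤ.+ + n ℤ.* pos (B k i) ℤ.- pos (B i k) ℤ.* + 0
      ≡⟨ cong (λ z → B x i ℤ.+ + n ℤ.* pos (B k i) ℤ.- z) (ℤP.*-zeroʳ (pos (B i k))) ⟩
    B x i ℤ.+ + n ℤ.* pos (B k i) ℤ.- + 0
      ≡⟨ ℤP.+-identityʳ _ ⟩
    B x i ℤ.+ + n ℤ.* pos (B k i) ∎

module GaleRobinson (N r s : ℕ) .{{_ : NonZero N}} (1≤r : 1 ≤ r) (r<s : r < s) (2s≤N : 2 * s ≤ N) where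

  r≤s : r ≤ s
  r≤s = ℕP.<⇒≤ r<s

  s+s≤N : s ℕ.+ s ≤ N
  s+s≤N = subst (_≤ N) (cong (s ℕ.+_) (ℕP.+-identityʳ s)) 2s≤N

  s≤N : s ≤ N
  s≤N = ℕP.m+n≤o⇒m≤o s s+s≤N

  r≤N : r ≤ N
  r≤N = ℕP.≤-trans r≤s s≤N

  1≤N : 1 ≤ N
  1≤N = ℕP.≤-trans 1≤r r≤N

  r<N : r < N
  r<N = ℕP.<-≤-trans r<s s≤N

  s≤N∸s : s ≤ N ∸ s
  s≤N∸s = ℕP.m+n≤o⇒m≤o∸n s s+s≤N

  r<N∸s : r < N ∸ s
  r<N∸s = ℕP.<-≤-trans r<s s≤N∸s

  N∸s<N∸r : N ∸ s < N ∸ r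
  N∸s<N∸r = ℕP.∸-monoʳ-< r<s s≤N

  s<N∸r : s < N ∸ r
  s<N∸r = ℕP.≤-<-trans s≤N∸s N∸s<N∸r

  s≤N∸r : s ≤ N ∸ r
  s≤N∸r = ℕP.<⇒≤ s<N∸r

  r<N∸r : r < N ∸ r
  r<N∸r = ℕP.<-trans r<s s<N∸r

  N∸r<N : N ∸ r < N
  N∸r<N = ℕP.∸-monoʳ-< {n = r} {o = 0} 1≤r r≤N

  1≤N∸r : 1 ≤ N ∸ r
  1≤N∸r = ℕP.m<n⇒0<n∸m r<N

  r+[N∸r]≡N : r ℕ.+ (N ∸ r) ≡ N
  r+[N∸r]≡N = ℕP.m+[n∸m]≡n r≤N

  [N∸s]+[s∸r]≡N∸r : (N ∸ s) ℕ.+ (s ∸ r) ≡ N ∸ r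
  [N∸s]+[s∸r]≡N∸r = trans (sym (ℕP.+-∸-assoc (N ∸ s) r≤s)) (cong (_∸ r) (ℕP.m∸n+n≡m s≤N))

  s+[N∸s∸r]≡N∸r : s ℕ.+ (N ∸ s ∸ r) ≡ N ∸ r
  s+[N∸s∸r]≡N∸r = trans (sym (ℕP.+-∸-assoc s (ℕP.<⇒≤ r<N∸s))) (cong (_∸ r) (ℕP.m+[n∸m]≡n s≤N))

  InRange : ℕ → Set
  InRange x = 1 ≤ x × x ≤ N

  -- The Gale–Robinson quiver on its mutable vertices

  rule3-guard : ℕ → ℕ → Bool
  rule3-guard i j = (r <ᵇ i) ∧ (j ≤ᵇ N ∸ r)

  rule3-guard-elim : ∀ i j → T (rule3-guard i j) → r < i × j ≤ N ∸ r
  rule3-guard-elim i j g = let r<i , j≤ = Equivalence.to (T-∧ {r <ᵇ i}) g in ℕP.<ᵇ⇒< r i r<i , ℕP.≤ᵇ⇒≤ j (N ∸ r) j≤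

  rule3-guard-intro : ∀ {i j} → r < i → j ≤ N ∸ r → T (rule3-guard i j)
  rule3-guard-intro {i} r<i j≤N∸r = Equivalence.from (T-∧ {r <ᵇ i}) (ℕP.<⇒<ᵇ r<i , ℕP.≤⇒≤ᵇ j≤N∸r)

  arr₁₂ : ℕ → ℕ → ℕ
  arr₁₂ i j = ind (j ≡ᵇ i ℕ.+ r) ℕ.+ ind (j ≡ᵇ i ℕ.+ (N ∸ r)) ℕ.+ ind (i ≡ᵇ j ℕ.+ s) ℕ.+ ind (i ≡ᵇ j ℕ.+ (N ∸ s))

  arr₃ : Bool → ℕ → ℕ → ℕ
  arr₃ g i j = ind (g ∧ (j ≡ᵇ i ℕ.+ (s ∸ r))) ℕ.+ ind (g ∧ (j ≡ᵇ i ℕ.+ (N ∸ s ∸ r)))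

  -- one summand per rule (1)–(3) of Q_N^{(r,s)}, with the parameter t solved for
  arr : ℕ → ℕ → ℕ
  arr i j = arr₁₂ i j ℕ.+ arr₃ (rule3-guard i j) i j

  β : ℕ → ℕ → ℤ
  β i j = + arr i j ℤ.- + arr j i

  infixl 6 _⟨+⟩_
  _⟨+⟩_ : ∀ {f g : ℕ → ℕ} {a b} → sum1 N f ≡ a → sum1 N g ≡ b → sum1 N (λ t → f t ℕ.+ g t) ≡ a ℕ.+ b
  _⟨+⟩_ = sum1-+-cong N

  frozen-from-mutable : ∀ {x y} → x ≤ N → frozenArrows N x y ≡ 0
  frozen-from-mutable {x} {y} x≤N = rule-empty N (λ _ → true) (N ℕ.+_) (λ t → t) {y = y} λ t 1≤t _ _ x≡N+t _ →
    ℕP.<⇒≱ (ℕP.m<m+n N 1≤t) (subst (_≤ N) x≡N+t x≤N)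

  module _ {i j : ℕ} (1≤i : 1 ≤ i) (i≤N : i ≤ N) (1≤j : 1 ≤ j) (j≤N : j ≤ N) where

    rule1a-count : sum1 N (λ t → ind ((t ≤ᵇ N ∸ r) ∧ (i ≡ᵇ t) ∧ (j ≡ᵇ t ℕ.+ r))) ≡ ind (j ≡ᵇ i ℕ.+ r)
    rule1a-count = rule-count N (_≤ᵇ N ∸ r) (λ t → t) (ℕ._+ r) i _ 1≤i i≤N (λ _ i≡t _ → sym i≡t)
      (λ _ _ → ℕP.≡⇒≡ᵇ j _)
      (λ h → let j≡ = ℕP.≡ᵇ⇒≡ j _ h in ℕP.≤⇒≤ᵇ (ℕP.m+n≤o⇒m≤o∸n i (subst (_≤ N) j≡ j≤N)) , refl , j≡)

    rule1b-count : sum1 N (λ t → ind ((t ≤ᵇ r) ∧ (i ≡ᵇ t) ∧ (j ≡ᵇ (N ∸ r) ℕ.+ t))) ≡ ind (j ≡ᵇ i ℕ.+ (N ∸ r))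
    rule1b-count = rule-count N (_≤ᵇ r) (λ t → t) ((N ∸ r) ℕ.+_) i _ 1≤i i≤N (λ _ i≡t _ → sym i≡t)
      (λ _ _ j≡ → ℕP.≡⇒≡ᵇ j _ (trans j≡ (ℕP.+-comm (N ∸ r) i)))
      (λ h → let j≡ = ℕP.≡ᵇ⇒≡ j _ h in
        ℕP.≤⇒≤ᵇ (subst (i ≤_) (ℕP.m∸[m∸n]≡n r≤N) (ℕP.m+n≤o⇒m≤o∸n i (subst (_≤ N) j≡ j≤N))) ,
        refl , trans j≡ (ℕP.+-comm i (N ∸ r)))

    rule2a-count : sum1 N (λ t → ind ((t ≤ᵇ N ∸ s) ∧ (i ≡ᵇ s ℕ.+ t) ∧ (j ≡ᵇ t))) ≡ ind (i ≡ᵇ j ℕ.+ s)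
    rule2a-count = rule-count N (_≤ᵇ N ∸ s) (s ℕ.+_) (λ t → t) j _ 1≤j j≤N (λ _ _ j≡t → sym j≡t)
      (λ _ i≡ _ → ℕP.≡⇒≡ᵇ i _ (trans i≡ (ℕP.+-comm s j)))
      (λ h → let i≡ = ℕP.≡ᵇ⇒≡ i _ h in
        ℕP.≤⇒≤ᵇ (ℕP.m+n≤o⇒m≤o∸n j (subst (_≤ N) i≡ i≤N)) , trans i≡ (ℕP.+-comm j s) , refl)

    rule2b-count : sum1 N (λ t → ind ((t ≤ᵇ s) ∧ (i ≡ᵇ (N ∸ s) ℕ.+ t) ∧ (j ≡ᵇ t))) ≡ ind (i ≡ᵇ j ℕ.+ (N ∸ s))
    rule2b-count = rule-count N (_≤ᵇ s) ((N ∸ s) ℕ.+_) (λ t → t) j _ 1≤j j≤N (λ _ _ j≡t → sym j≡t)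
      (λ _ i≡ _ → ℕP.≡⇒≡ᵇ i _ (trans i≡ (ℕP.+-comm (N ∸ s) j)))
      (λ h → let i≡ = ℕP.≡ᵇ⇒≡ i _ h in
        ℕP.≤⇒≤ᵇ (subst (j ≤_) (ℕP.m∸[m∸n]≡n s≤N) (ℕP.m+n≤o⇒m≤o∸n j (subst (_≤ N) i≡ i≤N))) ,
        trans i≡ (ℕP.+-comm j (N ∸ s)) , refl)

    rule3-count : ∀ c g → r ≤ c → c ℕ.+ g ≡ N ∸ r →
                  sum1 N (λ t → ind ((t ≤ᵇ g) ∧ (i ≡ᵇ r ℕ.+ t) ∧ (j ≡ᵇ c ℕ.+ t))) ≡ ind (rule3-guard i j ∧ (j ≡ᵇ i ℕ.+ (c ∸ r)))
    rule3-count c g r≤c c+g≡N∸r with r ℕP.<? i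
    ... | no r≮i = trans (rule-empty N (_≤ᵇ g) (r ℕ.+_) (c ℕ.+_) {y = j} λ t 1≤t _ _ i≡r+t _ → r≮i (subst (r <_) (sym i≡r+t) (ℕP.m<m+n r 1≤t)))
                         (sym (ind-∧-refuted (rule3-guard i j) _ (r≮i ∘ proj₁ ∘ rule3-guard-elim i j)))
    ... | yes r<i = rule-count N (_≤ᵇ g) (r ℕ.+_) (c ℕ.+_) u _ (ℕP.m<n⇒0<n∸m r<i) (ℕP.≤-trans (ℕP.m∸n≤m i r) i≤N)
      (λ t i≡r+t _ → trans (sym (ℕP.m+n∸m≡n r t)) (cong (_∸ r) (sym i≡r+t)))
      (λ u≤g _ j≡c+u → Equivalence.from (T-∧ {rule3-guard i j})
        (rule3-guard-intro r<i (subst (_≤ N ∸ r) (sym j≡c+u) (c+u≤N∸r (ℕP.≤ᵇ⇒≤ u g u≤g))) , ℕP.≡⇒≡ᵇ j _ (trans j≡c+u c+u≡i+[c∸r])))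
      (λ h → let guard , j≡ = Equivalence.to (T-∧ {rule3-guard i j}) h
                 j≤N∸r = proj₂ (rule3-guard-elim i j guard)
                 j≡c+u = trans (ℕP.≡ᵇ⇒≡ j _ j≡) (sym c+u≡i+[c∸r])
             in ℕP.≤⇒≤ᵇ (ℕP.+-cancelˡ-≤ c u g (subst₂ _≤_ j≡c+u (sym c+g≡N∸r) j≤N∸r)) , i≡r+u , j≡c+u)
      where
      u : ℕ
      u = i ∸ r
      i≡r+u : i ≡ r ℕ.+ u
      i≡r+u = sym (ℕP.m+[n∸m]≡n (ℕP.<⇒≤ r<i))
      c+u≤N∸r : u ≤ g → c ℕ.+ u ≤ N ∸ r
      c+u≤N∸r u≤g = subst (c ℕ.+ u ≤_) c+g≡N∸r (ℕP.+-monoʳ-≤ c u≤g)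
      c+u≡i+[c∸r] : c ℕ.+ u ≡ i ℕ.+ (c ∸ r)
      c+u≡i+[c∸r] = begin
        c ℕ.+ u               ≡⟨ cong (ℕ._+ u) (sym (ℕP.m+[n∸m]≡n r≤c)) ⟩
        r ℕ.+ (c ∸ r) ℕ.+ u   ≡⟨ ℕP.+-assoc r (c ∸ r) u ⟩
        r ℕ.+ ((c ∸ r) ℕ.+ u) ≡⟨ cong (r ℕ.+_) (ℕP.+-comm (c ∸ r) u) ⟩
        r ℕ.+ (u ℕ.+ (c ∸ r)) ≡⟨ sym (ℕP.+-assoc r u (c ∸ r)) ⟩
        r ℕ.+ u ℕ.+ (c ∸ r)   ≡⟨ cong (ℕ._+ (c ∸ r)) (sym i≡r+u) ⟩
        i ℕ.+ (c ∸ r)         ∎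
        where open ≡-Reasoning

    arrows-mutable : allArrows N r s i j ≡ arr i j
    arrows-mutable = begin
      grArrows N r s i j ℕ.+ frozenArrows N i j ≡⟨ cong (grArrows N r s i j ℕ.+_) (frozen-from-mutable {y = j} i≤N) ⟩
      grArrows N r s i j ℕ.+ 0                  ≡⟨ ℕP.+-identityʳ _ ⟩
      grArrows N r s i j                        ≡⟨ grArrows-mutable ⟩
      arr₁₂ i j ℕ.+ _ ℕ.+ _                     ≡⟨ ℕP.+-assoc (arr₁₂ i j) _ _ ⟩
      arr i j                                   ∎
      where
      open ≡-Reasoning
      grArrows-mutable : grArrows N r s i j ≡ arr₁₂ i j ℕ.+ ind (rule3-guard i j ∧ (j ≡ᵇ i ℕ.+ (s ∸ r)))
                                                       ℕ.+ ind (rule3-guard i j ∧ (j ≡ᵇ i ℕ.+ (N ∸ s ∸ r)))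
      grArrows-mutable = rule1a-count ⟨+⟩ rule1b-count ⟨+⟩ rule2a-count ⟨+⟩ rule2b-count
                         ⟨+⟩ rule3-count s (N ∸ r ∸ s) r≤s (ℕP.m+[n∸m]≡n s≤N∸r)
                         ⟨+⟩ rule3-count (N ∸ s) (s ∸ r) (ℕP.<⇒≤ r<N∸s) [N∸s]+[s∸r]≡N∸r

  initB-mutable : ∀ {i j} → InRange i → InRange j → initB N r s i j ≡ β i j
  initB-mutable (1≤i , i≤N) (1≤j , j≤N) =
    cong₂ (λ a b → + a ℤ.- + b) (arrows-mutable 1≤i i≤N 1≤j j≤N) (arrows-mutable 1≤j j≤N 1≤i i≤N)

  gr-off-quiver : ∀ x y → N < x ⊎ N < y → grArrows N r s x y ≡ 0
  gr-off-quiver x y out =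
    off (_≤ᵇ N ∸ r) (λ t → t) (ℕ._+ r) (λ t t≤N g →
      t≤N , subst (_≤ N) (ℕP.+-comm r t) (within r (ℕP.≤-reflexive r+[N∸r]≡N) (ℕP.≤ᵇ⇒≤ t _ g)))
    ⟨+⟩ off (_≤ᵇ r) (λ t → t) ((N ∸ r) ℕ.+_) (λ t t≤N g →
      t≤N , within (N ∸ r) (ℕP.≤-reflexive (ℕP.m∸n+n≡m r≤N)) (ℕP.≤ᵇ⇒≤ t r g))
    ⟨+⟩ off (_≤ᵇ N ∸ s) (s ℕ.+_) (λ t → t) (λ t t≤N g →
      within s (ℕP.≤-reflexive (ℕP.m+[n∸m]≡n s≤N)) (ℕP.≤ᵇ⇒≤ t _ g) , t≤N)
    ⟨+⟩ off (_≤ᵇ s) ((N ∸ s) ℕ.+_) (λ t → t) (λ t t≤N g →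
      within (N ∸ s) (ℕP.≤-reflexive (ℕP.m∸n+n≡m s≤N)) (ℕP.≤ᵇ⇒≤ t s g) , t≤N)
    ⟨+⟩ off (_≤ᵇ N ∸ r ∸ s) (r ℕ.+_) (s ℕ.+_) (λ t _ g → let t≤ = ℕP.≤ᵇ⇒≤ t _ g in
      within r (ℕP.≤-trans (ℕP.+-monoʳ-≤ r (ℕP.m∸n≤m (N ∸ r) s)) (ℕP.≤-reflexive r+[N∸r]≡N)) t≤ ,
      within s (ℕP.≤-trans (ℕP.≤-reflexive (ℕP.m+[n∸m]≡n s≤N∸r)) (ℕP.m∸n≤m N r)) t≤)
    ⟨+⟩ off (_≤ᵇ s ∸ r) (r ℕ.+_) ((N ∸ s) ℕ.+_) (λ t _ g → let t≤ = ℕP.≤ᵇ⇒≤ t _ g in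
      within r (ℕP.≤-trans (ℕP.≤-reflexive (ℕP.m+[n∸m]≡n r≤s)) s≤N) t≤ ,
      within (N ∸ s) (ℕP.≤-trans (ℕP.≤-reflexive [N∸s]+[s∸r]≡N∸r) (ℕP.m∸n≤m N r)) t≤)
    where
    within : ∀ c {d t} → c ℕ.+ d ≤ N → t ≤ d → c ℕ.+ t ≤ N
    within c c+d≤N t≤d = ℕP.≤-trans (ℕP.+-monoʳ-≤ c t≤d) c+d≤N
    off : ∀ (g : ℕ → Bool) (f h : ℕ → ℕ) → (∀ t → t ≤ N → T (g t) → f t ≤ N × h t ≤ N) →
          sum1 N (λ t → ind (g t ∧ (x ≡ᵇ f t) ∧ (y ≡ᵇ h t))) ≡ 0
    off g f h bounds = rule-empty N g f h λ t _ t≤N gt x≡f y≡h → let f≤N , h≤N = bounds t t≤N gt in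
      [ (λ N<x → ℕP.<⇒≱ N<x (subst (_≤ N) (sym x≡f) f≤N)) , (λ N<y → ℕP.<⇒≱ N<y (subst (_≤ N) (sym y≡h) h≤N)) ]′ out

  frozen-count : ∀ i {j} → 1 ≤ j → j ≤ N → frozenArrows N (N ℕ.+ j) i ≡ ind (i ≡ᵇ j)
  frozen-count i {j} 1≤j j≤N = rule-count N (λ _ → true) (N ℕ.+_) (λ t → t) j _ 1≤j j≤N
    (λ t N+j≡N+t _ → ℕP.+-cancelˡ-≡ N t j (sym N+j≡N+t)) (λ _ _ → ℕP.≡⇒≡ᵇ i j) (λ h → tt , refl , ℕP.≡ᵇ⇒≡ i j h)

  cvec-initial : ∀ {i j} → InRange i → InRange j → cvec N r s 0 i j ≡ + ind (i ≡ᵇ j)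
  cvec-initial {i} {j} (1≤i , i≤N) (1≤j , j≤N) = begin
    + allArrows N r s (N ℕ.+ j) i ℤ.- + allArrows N r s i (N ℕ.+ j)
      ≡⟨ cong₂ (λ a b → + a ℤ.- + b) (cong₂ ℕ._+_ (gr-off-quiver (N ℕ.+ j) i (inj₁ N<N+j)) (frozen-count i 1≤j j≤N))
                                      (cong₂ ℕ._+_ (gr-off-quiver i (N ℕ.+ j) (inj₂ N<N+j)) (frozen-from-mutable {y = N ℕ.+ j} i≤N)) ⟩
    + ind (i ≡ᵇ j) ℤ.- + 0 ≡⟨ ℤP.+-identityʳ _ ⟩
    + ind (i ≡ᵇ j)         ∎
    where
    open ≡-Reasoning
    N<N+j : N < N ℕ.+ j
    N<N+j = ℕP.m<m+n N 1≤j

  -- Periodicity under mutation at position 1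

  out₁ in₁ : ℕ → ℕ
  out₁ x = ind (x ≡ᵇ suc r) ℕ.+ ind (x ≡ᵇ suc (N ∸ r))
  in₁  x = ind (x ≡ᵇ suc s) ℕ.+ ind (x ≡ᵇ suc (N ∸ s))

  out₁-vanishes : ∀ {x} → x ≢ r → x ≢ N ∸ r → out₁ (suc x) ≡ 0
  out₁-vanishes x≢r x≢N∸r = cong₂ ℕ._+_ (ind-≢ x≢r) (ind-≢ x≢N∸r)

  in₁-vanishes : ∀ {x} → x ≢ s → x ≢ N ∸ s → in₁ (suc x) ≡ 0
  in₁-vanishes x≢s x≢N∸s = cong₂ ℕ._+_ (ind-≢ x≢s) (ind-≢ x≢N∸s)

  out₁-r : out₁ (suc r) ≡ 1
  out₁-r = cong₂ ℕ._+_ (ind-refl r) (ind-≢ (ℕP.<⇒≢ r<N∸r))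

  out₁-N∸r : out₁ (suc (N ∸ r)) ≡ 1
  out₁-N∸r = cong₂ ℕ._+_ (ind-≢ (ℕP.>⇒≢ r<N∸r)) (ind-refl (N ∸ r))

  in₁-r : in₁ (suc r) ≡ 0
  in₁-r = in₁-vanishes (ℕP.<⇒≢ r<s) (ℕP.<⇒≢ r<N∸s)

  in₁-N∸r : in₁ (suc (N ∸ r)) ≡ 0
  in₁-N∸r = in₁-vanishes (ℕP.>⇒≢ s<N∸r) (ℕP.>⇒≢ N∸s<N∸r)

  in₁-or-out₁-vanishes : ∀ x → in₁ (suc x) ≡ 0 ⊎ out₁ (suc x) ≡ 0
  in₁-or-out₁-vanishes x with x ℕP.≟ r | x ℕP.≟ N ∸ r
  ... | yes refl | _        = inj₁ in₁-r
  ... | no _     | yes refl = inj₁ in₁-N∸r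
  ... | no x≢r   | no x≢N∸r = inj₂ (out₁-vanishes x≢r x≢N∸r)

  arr₃-unguarded : ∀ g i j → ¬ T g → arr₃ g i j ≡ 0
  arr₃-unguarded g i j ¬g = cong₂ ℕ._+_ (ind-∧-refuted g _ ¬g) (ind-∧-refuted g _ ¬g)

  arr₃-backward : ∀ g {i j} → j < i → arr₃ g i j ≡ 0
  arr₃-backward g {i} {j} j<i = cong₂ ℕ._+_ (ind-false (no-arrow (s ∸ r))) (ind-false (no-arrow (N ∸ s ∸ r)))
    where
    no-arrow : ∀ c → ¬ T (g ∧ (j ≡ᵇ i ℕ.+ c))
    no-arrow c h = ℕP.<⇒≱ j<i (subst (i ≤_) (sym (ℕP.≡ᵇ⇒≡ j _ (proj₂ (Equivalence.to (T-∧ {g}) h)))) (ℕP.m≤m+n i c))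

  arr-from-1 : ∀ b → arr 1 (2 ℕ.+ b) ≡ out₁ (2 ℕ.+ b)
  arr-from-1 b = begin
    out₁ (2 ℕ.+ b) ℕ.+ 0 ℕ.+ 0 ℕ.+ arr₃ (rule3-guard 1 (2 ℕ.+ b)) 1 (2 ℕ.+ b)
      ≡⟨ cong (out₁ (2 ℕ.+ b) ℕ.+ 0 ℕ.+ 0 ℕ.+_)
              (arr₃-unguarded (rule3-guard 1 (2 ℕ.+ b)) 1 (2 ℕ.+ b) (ℕP.≤⇒≯ 1≤r ∘ proj₁ ∘ rule3-guard-elim 1 (2 ℕ.+ b))) ⟩
    out₁ (2 ℕ.+ b) ℕ.+ 0 ℕ.+ 0 ℕ.+ 0 ≡⟨ trans (ℕP.+-identityʳ _) (trans (ℕP.+-identityʳ _) (ℕP.+-identityʳ _)) ⟩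
    out₁ (2 ℕ.+ b)                   ∎
    where open ≡-Reasoning

  arr-to-1 : ∀ a → arr (2 ℕ.+ a) 1 ≡ in₁ (2 ℕ.+ a)
  arr-to-1 a = trans (cong (ℕ._+_ (in₁ (2 ℕ.+ a))) (arr₃-backward (rule3-guard (2 ℕ.+ a) 1) {2 ℕ.+ a} (s≤s (s≤s z≤n)))) (ℕP.+-identityʳ _)

  arr-from-N : ∀ {b} → b < N → arr N b ≡ in₁ (suc b)
  arr-from-N {b} b<N = begin
    arr₁₂ N b ℕ.+ arr₃ (rule3-guard N b) N b
      ≡⟨ cong₂ ℕ._+_ (cong₂ ℕ._+_ (cong₂ ℕ._+_ (cong₂ ℕ._+_ (ind-beyond r b<N) (ind-beyond (N ∸ r) b<N))
                                              (ind-≡ᵇ-∸ s≤N))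
                                 (trans (ind-≡ᵇ-∸ (ℕP.m∸n≤m N s)) (cong (λ c → ind (b ≡ᵇ c)) (ℕP.m∸[m∸n]≡n s≤N))))
                     (arr₃-backward (rule3-guard N b) b<N) ⟩
    ind (b ≡ᵇ N ∸ s) ℕ.+ ind (b ≡ᵇ s) ℕ.+ 0 ≡⟨ trans (ℕP.+-identityʳ _) (ℕP.+-comm (ind (b ≡ᵇ N ∸ s)) _) ⟩
    in₁ (suc b)                             ∎
    where open ≡-Reasoning

  arr-to-N : ∀ {b} → b < N → arr b N ≡ out₁ (suc b)
  arr-to-N {b} b<N = begin
    arr₁₂ b N ℕ.+ arr₃ (rule3-guard b N) b N
      ≡⟨ cong₂ ℕ._+_ (cong₂ ℕ._+_ (cong₂ ℕ._+_ (cong₂ ℕ._+_ (ind-≡ᵇ-∸ r≤N)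
                                                          (trans (ind-≡ᵇ-∸ (ℕP.m∸n≤m N r)) (cong (λ c → ind (b ≡ᵇ c)) (ℕP.m∸[m∸n]≡n r≤N))))
                                              (ind-beyond s b<N))
                                 (ind-beyond (N ∸ s) b<N))
                     (arr₃-unguarded (rule3-guard b N) b N (ℕP.<⇒≱ N∸r<N ∘ proj₂ ∘ rule3-guard-elim b N)) ⟩
    ind (b ≡ᵇ N ∸ r) ℕ.+ ind (b ≡ᵇ r) ℕ.+ 0 ℕ.+ 0 ℕ.+ 0
      ≡⟨ trans (ℕP.+-identityʳ _) (trans (ℕP.+-identityʳ _) (trans (ℕP.+-identityʳ _) (ℕP.+-comm (ind (b ≡ᵇ N ∸ r)) _))) ⟩
    out₁ (suc b)                                        ∎
    where open ≡-Reasoning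

  rule3-guard-shift : ∀ {a b} → a ≢ r → b ≢ N ∸ r → rule3-guard (suc a) (suc b) ≡ rule3-guard a b
  rule3-guard-shift {a} {b} a≢r b≢N∸r = cong₂ _∧_
    (T-ext (λ h → ℕP.<⇒<ᵇ (ℕP.≤∧≢⇒< (ℕP.≤-pred (ℕP.<ᵇ⇒< r (suc a) h)) (a≢r ∘ sym)))
           (λ h → ℕP.<⇒<ᵇ (ℕP.m≤n⇒m≤1+n (ℕP.<ᵇ⇒< r a h))))
    (T-ext (λ h → ℕP.≤⇒≤ᵇ (ℕP.<⇒≤ (ℕP.≤ᵇ⇒≤ (suc b) _ h)))
           (λ h → ℕP.≤⇒≤ᵇ (ℕP.≤∧≢⇒< (ℕP.≤ᵇ⇒≤ b _ h) b≢N∸r)))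

  -- the guard of rule (3) moves only at a = r and b = N − r, where the arrows created by mutating at 1 make up for it
  arr₃-shift : ∀ {a b} → a < b → b < N →
               arr₃ (rule3-guard (suc a) (suc b)) a b ℕ.+ in₁ (suc a) * out₁ (suc b)
               ≡ arr₃ (rule3-guard a b) a b ℕ.+ in₁ (suc b) * out₁ (suc a)
  arr₃-shift {a} {b} a<b b<N with a ℕP.≟ r | b ℕP.≟ N ∸ r
  ... | yes refl | _ = begin
    arr₃ (rule3-guard (suc r) (suc b)) r b ℕ.+ in₁ (suc r) * out₁ (suc b)
      ≡⟨ cong₂ ℕ._+_ (cong₂ ℕ._+_ (created s r≤s s<N∸r) (created (N ∸ s) (ℕP.<⇒≤ r<N∸s) N∸s<N∸r))
                     (cong (_* out₁ (suc b)) in₁-r) ⟩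
    in₁ (suc b) ℕ.+ 0                              ≡⟨ ℕP.+-identityʳ _ ⟩
    in₁ (suc b)                                    ≡⟨ sym (ℕP.*-identityʳ _) ⟩
    in₁ (suc b) * 1                                ≡⟨ cong (in₁ (suc b) *_) (sym out₁-r) ⟩
    in₁ (suc b) * out₁ (suc r)                     ≡⟨ cong (ℕ._+ in₁ (suc b) * out₁ (suc r))
                                                        (sym (arr₃-unguarded (rule3-guard r b) r b (ℕP.<-irrefl refl ∘ proj₁ ∘ rule3-guard-elim r b))) ⟩
    arr₃ (rule3-guard r b) r b ℕ.+ in₁ (suc b) * out₁ (suc r) ∎
    where
    open ≡-Reasoning
    created : ∀ c → r ≤ c → c < N ∸ r → ind (rule3-guard (suc r) (suc b) ∧ (b ≡ᵇ r ℕ.+ (c ∸ r))) ≡ ind (b ≡ᵇ c)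
    created c r≤c c<N∸r = trans (ind-∧-implied (rule3-guard (suc r) (suc b)) _ λ h →
                                  rule3-guard-intro ℕP.≤-refl
                                    (subst (λ x → suc x ≤ N ∸ r) (sym (trans (ℕP.≡ᵇ⇒≡ b _ h) (ℕP.m+[n∸m]≡n r≤c))) c<N∸r))
                                (cong (λ x → ind (b ≡ᵇ x)) (ℕP.m+[n∸m]≡n r≤c))
  ... | no a≢r | yes refl = begin
    arr₃ (rule3-guard (suc a) (suc (N ∸ r))) a (N ∸ r) ℕ.+ in₁ (suc a) * out₁ (suc (N ∸ r))
      ≡⟨ cong₂ ℕ._+_ (arr₃-unguarded (rule3-guard (suc a) (suc (N ∸ r))) a (N ∸ r) (ℕP.<-irrefl refl ∘ proj₂ ∘ rule3-guard-elim (suc a) _))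
                     (cong (in₁ (suc a) *_) out₁-N∸r) ⟩
    in₁ (suc a) * 1                                     ≡⟨ ℕP.*-identityʳ _ ⟩
    ind (a ≡ᵇ s) ℕ.+ ind (a ≡ᵇ N ∸ s)                   ≡⟨ ℕP.+-comm (ind (a ≡ᵇ s)) _ ⟩
    ind (a ≡ᵇ N ∸ s) ℕ.+ ind (a ≡ᵇ s)                   ≡⟨ cong₂ ℕ._+_ (sym (removed (N ∸ s) r<N∸s [N∸s]+[s∸r]≡N∸r))
                                                                     (sym (removed s r<s s+[N∸s∸r]≡N∸r)) ⟩
    arr₃ (rule3-guard a (N ∸ r)) a (N ∸ r)              ≡⟨ sym (ℕP.+-identityʳ _) ⟩
    arr₃ (rule3-guard a (N ∸ r)) a (N ∸ r) ℕ.+ 0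
      ≡⟨ cong (arr₃ (rule3-guard a (N ∸ r)) a (N ∸ r) ℕ.+_) (cong (_* out₁ (suc a)) (sym in₁-N∸r)) ⟩
    arr₃ (rule3-guard a (N ∸ r)) a (N ∸ r) ℕ.+ in₁ (suc (N ∸ r)) * out₁ (suc a) ∎
    where
    open ≡-Reasoning
    removed : ∀ c {d} → r < c → c ℕ.+ d ≡ N ∸ r → ind (rule3-guard a (N ∸ r) ∧ (N ∸ r ≡ᵇ a ℕ.+ d)) ≡ ind (a ≡ᵇ c)
    removed c {d} r<c c+d≡N∸r = trans (ind-∧-implied (rule3-guard a (N ∸ r)) _ λ h →
                                        rule3-guard-intro (subst (r <_) (sym (a≡c (ℕP.≡ᵇ⇒≡ (N ∸ r) _ h))) r<c) ℕP.≤-refl)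
                                      (ind-≡ᵇ-cancelʳ a c+d≡N∸r)
      where a≡c : N ∸ r ≡ a ℕ.+ d → a ≡ c
            a≡c eq = ℕP.+-cancelʳ-≡ d a c (trans (sym eq) (sym c+d≡N∸r))
  ... | no a≢r | no b≢N∸r = begin
    arr₃ (rule3-guard (suc a) (suc b)) a b ℕ.+ in₁ (suc a) * out₁ (suc b)
      ≡⟨ cong₂ ℕ._+_ (cong (λ g → arr₃ g a b) (rule3-guard-shift a≢r b≢N∸r)) no-in₁-out₁ ⟩
    arr₃ (rule3-guard a b) a b ℕ.+ 0
      ≡⟨ cong (arr₃ (rule3-guard a b) a b ℕ.+_) (sym no-in₁-out₁′) ⟩
    arr₃ (rule3-guard a b) a b ℕ.+ in₁ (suc b) * out₁ (suc a) ∎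
    where
    open ≡-Reasoning
    no-in₁-out₁ : in₁ (suc a) * out₁ (suc b) ≡ 0
    no-in₁-out₁ with b ℕP.≟ r
    ... | yes b≡r = let a<r = subst (a <_) b≡r a<b in
      cong (_* out₁ (suc b)) (in₁-vanishes (ℕP.<⇒≢ (ℕP.<-trans a<r r<s)) (ℕP.<⇒≢ (ℕP.<-trans a<r r<N∸s)))
    ... | no b≢r   = trans (cong (in₁ (suc a) *_) (out₁-vanishes b≢r b≢N∸r)) (ℕP.*-zeroʳ (in₁ (suc a)))
    no-in₁-out₁′ : in₁ (suc b) * out₁ (suc a) ≡ 0
    no-in₁-out₁′ with a ℕP.≟ N ∸ r
    ... | yes a≡N∸r = let N∸r<b = subst (_< b) a≡N∸r a<b in
      cong (_* out₁ (suc a)) (in₁-vanishes (ℕP.>⇒≢ (ℕP.<-trans s<N∸r N∸r<b)) (ℕP.>⇒≢ (ℕP.<-trans N∸s<N∸r N∸r<b)))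
    ... | no a≢N∸r = trans (cong (in₁ (suc b) *_) (out₁-vanishes a≢r a≢N∸r)) (ℕP.*-zeroʳ (in₁ (suc b)))

  -- β(a+1, b+1) + [β(a+1, 1)]₊ [β(1, b+1)]₊ − [β(b+1, 1)]₊ [β(1, a+1)]₊ = β(a, b), with the subtractions moved across
  arr-shift-< : ∀ {a b} → a < b → b < N →
                arr (suc a) (suc b) ℕ.+ in₁ (suc a) * out₁ (suc b) ℕ.+ arr b a
                ≡ arr a b ℕ.+ in₁ (suc b) * out₁ (suc a) ℕ.+ arr (suc b) (suc a)
  arr-shift-< {a} {b} a<b b<N = begin
    arr₁₂ a b ℕ.+ arr₃ (rule3-guard (suc a) (suc b)) a b ℕ.+ in₁ (suc a) * out₁ (suc b) ℕ.+ (arr₁₂ b a ℕ.+ arr₃ (rule3-guard b a) b a)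
      ≡⟨ cong₂ (λ x y → x ℕ.+ (arr₁₂ b a ℕ.+ y)) (ℕP.+-assoc (arr₁₂ a b) _ _) (arr₃-backward (rule3-guard b a) a<b) ⟩
    arr₁₂ a b ℕ.+ (arr₃ (rule3-guard (suc a) (suc b)) a b ℕ.+ in₁ (suc a) * out₁ (suc b)) ℕ.+ (arr₁₂ b a ℕ.+ 0)
      ≡⟨ cong (λ x → arr₁₂ a b ℕ.+ x ℕ.+ (arr₁₂ b a ℕ.+ 0)) (arr₃-shift a<b b<N) ⟩
    arr₁₂ a b ℕ.+ (arr₃ (rule3-guard a b) a b ℕ.+ in₁ (suc b) * out₁ (suc a)) ℕ.+ (arr₁₂ b a ℕ.+ 0)
      ≡⟨ sym (cong₂ (λ x y → x ℕ.+ (arr₁₂ b a ℕ.+ y)) (ℕP.+-assoc (arr₁₂ a b) _ _) (arr₃-backward (rule3-guard (suc b) (suc a)) a<b)) ⟩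
    arr₁₂ a b ℕ.+ arr₃ (rule3-guard a b) a b ℕ.+ in₁ (suc b) * out₁ (suc a) ℕ.+ (arr₁₂ b a ℕ.+ arr₃ (rule3-guard (suc b) (suc a)) b a) ∎
    where open ≡-Reasoning

  arr-shift : ∀ {a b} → a < N → b < N →
              arr (suc a) (suc b) ℕ.+ in₁ (suc a) * out₁ (suc b) ℕ.+ arr b a
              ≡ arr a b ℕ.+ in₁ (suc b) * out₁ (suc a) ℕ.+ arr (suc b) (suc a)
  arr-shift {a} {b} a<N b<N with ℕP.<-cmp a b
  ... | tri< a<b _ _ = arr-shift-< a<b b<N
  ... | tri≈ _ refl _ = +-swap-outer (arr (suc a) (suc a)) _ (arr a a)
  ... | tri> _ _ b<a = trans (+-swap-outer (arr (suc a) (suc b)) _ (arr b a))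
                             (trans (sym (arr-shift-< b<a a<N)) (+-swap-outer (arr (suc b) (suc a)) _ (arr a b)))

  rot : ℕ → ℕ
  rot zero          = zero
  rot (suc zero)    = N
  rot (suc (suc p)) = suc p

  β-skew : ∀ x y → β x y ≡ - β y x
  β-skew x y = diff-skew (+ arr x y) (+ arr y x)
    where diff-skew : ∀ a b → a ℤ.- b ≡ - (b ℤ.- a)
          diff-skew = solve-∀

  β-diag : ∀ x → β x x ≡ + 0
  β-diag x = ℤP.+-inverseʳ (+ arr x x)

  pos-β-to-1 : ∀ a → pos (β (2 ℕ.+ a) 1) ≡ + in₁ (2 ℕ.+ a)
  pos-β-to-1 a = trans (cong₂ (λ x y → pos (+ x ℤ.- + y)) (arr-to-1 a) (arr-from-1 a))
                       (pos-diff _ _ (in₁-or-out₁-vanishes (suc a)))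

  pos-β-from-1 : ∀ b → pos (β 1 (2 ℕ.+ b)) ≡ + out₁ (2 ℕ.+ b)
  pos-β-from-1 b = trans (cong₂ (λ x y → pos (+ x ℤ.- + y)) (arr-from-1 b) (arr-to-1 b))
                         (pos-diff _ _ (swap (in₁-or-out₁-vanishes (suc b))))

  β-from-1 : ∀ {b} → 2 ℕ.+ b ≤ N → - β 1 (2 ℕ.+ b) ≡ β N (suc b)
  β-from-1 {b} b<N = begin
    - (+ arr 1 (2 ℕ.+ b) ℤ.- + arr (2 ℕ.+ b) 1) ≡⟨ cong₂ (λ x y → - (+ x ℤ.- + y)) (arr-from-1 b) (arr-to-1 b) ⟩
    - (+ out₁ (2 ℕ.+ b) ℤ.- + in₁ (2 ℕ.+ b))    ≡⟨ neg-diff (+ out₁ (2 ℕ.+ b)) (+ in₁ (2 ℕ.+ b)) ⟩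
    + in₁ (2 ℕ.+ b) ℤ.- + out₁ (2 ℕ.+ b)        ≡⟨ sym (cong₂ (λ x y → + x ℤ.- + y) (arr-from-N b<N) (arr-to-N b<N)) ⟩
    β N (suc b)                                 ∎
    where open ≡-Reasoning
          neg-diff : ∀ x y → - (x ℤ.- y) ≡ y ℤ.- x
          neg-diff = solve-∀

  β-to-1 : ∀ {a} → 2 ℕ.+ a ≤ N → - β (2 ℕ.+ a) 1 ≡ β (suc a) N
  β-to-1 {a} a<N = begin
    - β (2 ℕ.+ a) 1     ≡⟨ cong -_ (β-skew (2 ℕ.+ a) 1) ⟩
    - - β 1 (2 ℕ.+ a)   ≡⟨ cong -_ (β-from-1 a<N) ⟩
    - β N (suc a)       ≡⟨ sym (β-skew (suc a) N) ⟩
    β (suc a) N         ∎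
    where open ≡-Reasoning

  mutate-β : ∀ {a b} → InRange a → InRange b → mutate 1 β a b ≡ β (rot a) (rot b)
  mutate-β {suc zero}    {suc zero}    _         _         = trans (cong -_ (β-diag 1)) (sym (β-diag N))
  mutate-β {suc zero}    {suc (suc b)} _         (_ , b≤N) = β-from-1 b≤N
  mutate-β {suc (suc a)} {suc zero}    (_ , a≤N) _         = β-to-1 a≤N
  mutate-β {suc (suc a)} {suc (suc b)} (_ , a≤N) (_ , b≤N) = begin
    β (2 ℕ.+ a) (2 ℕ.+ b) ℤ.+ pos (β (2 ℕ.+ a) 1) ℤ.* pos (β 1 (2 ℕ.+ b)) ℤ.- pos (β (2 ℕ.+ b) 1) ℤ.* pos (β 1 (2 ℕ.+ a))
      ≡⟨ cong₂ (λ x y → β (2 ℕ.+ a) (2 ℕ.+ b) ℤ.+ x ℤ.- y)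
               (trans (cong₂ ℤ._*_ (pos-β-to-1 a) (pos-β-from-1 b)) (sym (ℤP.pos-* (in₁ (2 ℕ.+ a)) _)))
               (trans (cong₂ ℤ._*_ (pos-β-to-1 b) (pos-β-from-1 a)) (sym (ℤP.pos-* (in₁ (2 ℕ.+ b)) _))) ⟩
    β (2 ℕ.+ a) (2 ℕ.+ b) ℤ.+ + (in₁ (2 ℕ.+ a) * out₁ (2 ℕ.+ b)) ℤ.- + (in₁ (2 ℕ.+ b) * out₁ (2 ℕ.+ a))
      ≡⟨ pos-balance (arr (2 ℕ.+ a) (2 ℕ.+ b)) (arr (2 ℕ.+ b) (2 ℕ.+ a)) (arr (suc a) (suc b)) (arr (suc b) (suc a)) _ _
                     (arr-shift a≤N b≤N) ⟩
    β (suc a) (suc b) ∎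
    where open ≡-Reasoning

  position : ℕ → ℕ → ℕ
  position zero    i = i
  position (suc ℓ) i = rot (position ℓ i)

  rot-range : ∀ {p} → InRange p → InRange (rot p)
  rot-range {suc zero}    _          = 1≤N , ℕP.≤-refl
  rot-range {suc (suc p)} (_ , p<N) = s≤s z≤n , ℕP.<⇒≤ p<N

  position-range : ∀ ℓ {i} → InRange i → InRange (position ℓ i)
  position-range zero    i∈ = i∈
  position-range (suc ℓ) i∈ = rot-range (position-range ℓ i∈)

  position-congruent : ∀ ℓ {i} → InRange i → ∃[ Q ] ℓ ℕ.+ position ℓ i ≡ Q * N ℕ.+ i
  position-congruent zero    _  = 0 , refl
  position-congruent (suc ℓ) {i} i∈ with position ℓ i | position-range ℓ i∈ | position-congruent ℓ i∈
  ... | suc zero    | _ | Q , ℓ+1≡ = suc Q , (begin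
    suc ℓ ℕ.+ N       ≡⟨ cong (ℕ._+ N) (trans (ℕP.+-comm 1 ℓ) ℓ+1≡) ⟩
    Q * N ℕ.+ i ℕ.+ N ≡⟨ rotate (Q * N) i N ⟩
    N ℕ.+ Q * N ℕ.+ i ∎)
    where open ≡-Reasoning
          rotate : ∀ a b c → a ℕ.+ b ℕ.+ c ≡ c ℕ.+ a ℕ.+ b
          rotate = ℕ-solve
  ... | suc (suc p) | _ | Q , ℓ+p≡ = Q , trans (sym (ℕP.+-suc ℓ (suc p))) ℓ+p≡

  position-injective : ∀ ℓ {i i′} → InRange i → InRange i′ → position ℓ i ≡ position ℓ i′ → i ≡ i′
  position-injective ℓ {i} {i′} i∈@(1≤i , i≤N) i′∈@(1≤i′ , i′≤N) same =
    let Q , eq = position-congruent ℓ i∈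
        Q′ , eq′ = position-congruent ℓ i′∈
    in residue-unique N Q Q′ 1≤i i≤N 1≤i′ i′≤N (trans (sym eq) (trans (cong (ℓ ℕ.+_) same) eq′))

  mutated : ℕ → ℕ
  mutated ℓ = ℓ % N ℕ.+ 1

  mutated-range : ∀ ℓ → InRange (mutated ℓ)
  mutated-range ℓ = subst (1 ≤_) (ℕP.+-comm 1 (ℓ % N)) (s≤s z≤n) , subst (_≤ N) (ℕP.+-comm 1 (ℓ % N)) (m%n<n ℓ N)

  position-mutated : ∀ ℓ → position ℓ (mutated ℓ) ≡ 1
  position-mutated ℓ =
    let p∈ = position-range ℓ (mutated-range ℓ)
        Q , eq = position-congruent ℓ (mutated-range ℓ)
    in residue-unique N (ℓ / N) Q (proj₁ p∈) (proj₂ p∈) (s≤s z≤n) 1≤N (ℕP.+-cancelˡ-≡ (ℓ % N) _ _ (begin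
      ℓ % N ℕ.+ (ℓ / N * N ℕ.+ position ℓ (mutated ℓ)) ≡⟨ sym (ℕP.+-assoc (ℓ % N) _ _) ⟩
      ℓ % N ℕ.+ ℓ / N * N ℕ.+ position ℓ (mutated ℓ)   ≡⟨ cong (ℕ._+ position ℓ (mutated ℓ)) (sym (m≡m%n+[m/n]*n ℓ N)) ⟩
      ℓ ℕ.+ position ℓ (mutated ℓ)                     ≡⟨ eq ⟩
      Q * N ℕ.+ (ℓ % N ℕ.+ 1)                         ≡⟨ exchange (Q * N) (ℓ % N) ⟩
      ℓ % N ℕ.+ (Q * N ℕ.+ 1)                         ∎))
    where open ≡-Reasoning
          exchange : ∀ a b → a ℕ.+ (b ℕ.+ 1) ≡ b ℕ.+ (a ℕ.+ 1)
          exchange = ℕ-solve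

  is-mutated : ∀ ℓ {x} → InRange x → (x ≡ᵇ mutated ℓ) ≡ (position ℓ x ≡ᵇ position ℓ (mutated ℓ))
  is-mutated ℓ {x} x∈ = T-ext
    (λ h → ℕP.≡⇒≡ᵇ _ _ (cong (position ℓ) (ℕP.≡ᵇ⇒≡ x _ h)))
    (λ h → ℕP.≡⇒≡ᵇ x _ (position-injective ℓ x∈ (mutated-range ℓ) (ℕP.≡ᵇ⇒≡ _ _ h)))

  periodic-quiver : ∀ ℓ {i j} → InRange i → InRange j → periodicB N r s ℓ i j ≡ β (position ℓ i) (position ℓ j)
  periodic-quiver zero    i∈ j∈ = initB-mutable i∈ j∈
  periodic-quiver (suc ℓ) {i} {j} i∈ j∈ = begin
    mutate (mutated ℓ) (periodicB N r s ℓ) i j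
      ≡⟨ mutate-relabel InRange (position ℓ) (periodicB N r s ℓ) β (mutated-range ℓ) i∈ j∈ (is-mutated ℓ) (periodic-quiver ℓ) ⟩
    mutate (position ℓ (mutated ℓ)) β (position ℓ i) (position ℓ j)
      ≡⟨ cong (λ k → mutate k β (position ℓ i) (position ℓ j)) (position-mutated ℓ) ⟩
    mutate 1 β (position ℓ i) (position ℓ j)
      ≡⟨ mutate-β (position-range ℓ i∈) (position-range ℓ j∈) ⟩
    β (position (suc ℓ) i) (position (suc ℓ) j) ∎
    where open ≡-Reasoning

  -- The vectors E and F

  instance
    r-nonZero : NonZero r
    r-nonZero = ℕ.>-nonZero 1≤r
    N∸r-nonZero : NonZero (N ∸ r)
    N∸r-nonZero = ℕ.>-nonZero 1≤N∸r

  χ : ℕ → ℕ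
  χ x = ind (does (N ∸ r ∣? x))

  D : ℕ → ℕ
  D y = d (+ y) r (N ∸ r)

  D-step : ∀ y → D (r ℕ.+ y) ≡ χ (r ℕ.+ y) ℕ.+ D y
  D-step y = d-step r (N ∸ r) y

  D-below : ∀ {y} → y < r → D y ≡ χ y
  D-below {y} y<r = d-below r (N ∸ r) y y<r

  χ-below : ∀ {x} → x < N ∸ r → χ x ≡ ind (x ≡ᵇ 0)
  χ-below {zero}  _       = cong ind (dec-true (N ∸ r ∣? 0) (divides 0 refl))
  χ-below {suc x} x<N∸r = cong ind (dec-false (N ∸ r ∣? suc x) (ℕP.<⇒≱ x<N∸r ∘ ∣⇒≤))

  χ-period : ∀ x → χ (x ℕ.+ (N ∸ r)) ≡ χ x
  χ-period x = cong ind (does-⇔ (mk⇔ (λ h → ∣m+n∣m⇒∣n (subst (N ∸ r ∣_) (ℕP.+-comm x (N ∸ r)) h) ∣-refl)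
                                      (λ h → ∣m∣n⇒∣m+n h ∣-refl))
                                 (N ∸ r ∣? (x ℕ.+ (N ∸ r))) (N ∸ r ∣? x))

  E-≥ : ∀ {m j} → j ≤ m → E N r (+ m) j ≡ + D (m ∸ j)
  E-≥ {m} {j} j≤m = cong (λ z → + d z r (N ∸ r)) (trans (ℤP.[+m]-[+n]≡m⊖n m j) (ℤP.⊖-≥ j≤m))

  E-< : ∀ {m j} → m < j → E N r (+ m) j ≡ + 0
  E-< {m} {j} m<j = cong (λ z → + d z r (N ∸ r)) (trans (ℤP.[+m]-[+n]≡m⊖n m j) (trans (ℤP.⊖-< m<j) (negative (ℕP.m<n⇒0<n∸m m<j))))
    where negative : ∀ {k} → 1 ≤ k → - (+ k) ≡ -[1+ ℕ.pred k ]
          negative {suc k} _ = refl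

  F-dist : ∀ x j → F N r (+ x ℤ.- + N) j ≡ + χ ℤ.∣ j ℤ.⊖ x ∣
  F-dist x j = begin
    (if does (N ∸ r ∣? ℤ.∣ + j ℤ.- (+ x ℤ.- + N ℤ.+ + N) ∣) then + 1 else + 0)
      ≡⟨ cong (λ z → if does (N ∸ r ∣? ℤ.∣ + j ℤ.- z ∣) then + 1 else + 0) (cancel (+ x) (+ N)) ⟩
    (if does (N ∸ r ∣? ℤ.∣ + j ℤ.- + x ∣) then + 1 else + 0)
      ≡⟨ cong (λ z → if does (N ∸ r ∣? ℤ.∣ z ∣) then + 1 else + 0) (ℤP.[+m]-[+n]≡m⊖n j x) ⟩
    (if χ′ then + 1 else + 0)
      ≡⟨ if-ind χ′ ⟩
    + χ ℤ.∣ j ℤ.⊖ x ∣ ∎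
    where
    open ≡-Reasoning
    χ′ : Bool
    χ′ = does (N ∸ r ∣? ℤ.∣ j ℤ.⊖ x ∣)
    cancel : ∀ a b → a ℤ.- b ℤ.+ b ≡ a
    cancel = solve-∀
    if-ind : ∀ c → (if c then + 1 else + 0) ≡ + ind c
    if-ind true  = refl
    if-ind false = refl

  F-≤ : ∀ {x j} → j ≤ x → F N r (+ x ℤ.- + N) j ≡ + χ (x ∸ j)
  F-≤ {x} {j} j≤x = trans (F-dist x j) (cong (λ z → + χ z) (ℤP.∣⊖∣-≤ j≤x))

  F-> : ∀ {x j} → x < j → F N r (+ x ℤ.- + N) j ≡ + χ (j ∸ x)
  F-> {x} {j} x<j = trans (F-dist x j) (cong (λ z → + χ z) (trans (ℤP.∣m⊖n∣≡∣n⊖m∣ j x) (ℤP.∣⊖∣-< x<j)))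

  F-period : ∀ z j → F N r (z ℤ.+ + (N ∸ r)) j ≡ F N r z j
  F-period z j = cong (λ b → if b then + 1 else + 0) (does-⇔ (mk⇔
    (λ h → subst (+ (N ∸ r) ℤ∣.∣_) (add-back w (+ (N ∸ r))) (ℤ∣.∣m∣n⇒∣m+n (subst (+ (N ∸ r) ℤ∣.∣_) shifted h) ℤ∣.∣-refl))
    (λ h → subst (+ (N ∸ r) ℤ∣.∣_) (sym shifted) (ℤ∣.∣m∣n⇒∣m-n h ℤ∣.∣-refl)))
    (+ (N ∸ r) ℤ∣.∣? (+ j ℤ.- (z ℤ.+ + (N ∸ r) ℤ.+ + N))) (+ (N ∸ r) ℤ∣.∣? w))
    where
    w : ℤ
    w = + j ℤ.- (z ℤ.+ + N)
    shifted : + j ℤ.- (z ℤ.+ + (N ∸ r) ℤ.+ + N) ≡ w ℤ.- + (N ∸ r)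
    shifted = regroup (+ j) z (+ (N ∸ r)) (+ N)
      where regroup : ∀ a b c d → a ℤ.- (b ℤ.+ c ℤ.+ d) ≡ a ℤ.- (b ℤ.+ d) ℤ.- c
            regroup = solve-∀
    add-back : ∀ a b → a ℤ.- b ℤ.+ b ≡ a
    add-back = solve-∀

  E-step : ∀ {m j} → 1 ≤ m → j ≤ N → F N r (+ (m ℕ.+ r) ℤ.- + N) j ℤ.+ E N r (+ m) j ≡ E N r (+ (m ℕ.+ r)) j
  E-step {m} {j} 1≤m j≤N with j ℕP.≤? m | j ℕP.≤? m ℕ.+ r
  ... | yes j≤m | _ = begin
    F N r (+ (m ℕ.+ r) ℤ.- + N) j ℤ.+ E N r (+ m) j ≡⟨ cong₂ ℤ._+_ (F-≤ j≤m+r) (E-≥ j≤m) ⟩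
    + χ (m ℕ.+ r ∸ j) ℤ.+ + D (m ∸ j)               ≡⟨ sym (ℤP.pos-+ (χ (m ℕ.+ r ∸ j)) _) ⟩
    + (χ (m ℕ.+ r ∸ j) ℕ.+ D (m ∸ j))               ≡⟨ cong (λ y → + (χ y ℕ.+ D (m ∸ j))) m+r∸j≡r+[m∸j] ⟩
    + (χ (r ℕ.+ (m ∸ j)) ℕ.+ D (m ∸ j))             ≡⟨ cong +_ (sym (D-step (m ∸ j))) ⟩
    + D (r ℕ.+ (m ∸ j))                             ≡⟨ cong (λ y → + D y) (sym m+r∸j≡r+[m∸j]) ⟩
    + D (m ℕ.+ r ∸ j)                               ≡⟨ sym (E-≥ j≤m+r) ⟩
    E N r (+ (m ℕ.+ r)) j                           ∎
    where
    open ≡-Reasoning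
    j≤m+r : j ≤ m ℕ.+ r
    j≤m+r = ℕP.≤-trans j≤m (ℕP.m≤m+n m r)
    m+r∸j≡r+[m∸j] : m ℕ.+ r ∸ j ≡ r ℕ.+ (m ∸ j)
    m+r∸j≡r+[m∸j] = trans (ℕP.+-∸-comm r j≤m) (ℕP.+-comm (m ∸ j) r)
  ... | no j≰m | yes j≤m+r = begin
    F N r (+ (m ℕ.+ r) ℤ.- + N) j ℤ.+ E N r (+ m) j ≡⟨ cong₂ ℤ._+_ (F-≤ j≤m+r) (E-< (ℕP.≰⇒> j≰m)) ⟩
    + χ (m ℕ.+ r ∸ j) ℤ.+ + 0                       ≡⟨ ℤP.+-identityʳ _ ⟩
    + χ (m ℕ.+ r ∸ j)                               ≡⟨ cong +_ (sym (D-below (ℕP.m<n+o⇒m∸n<o (m ℕ.+ r) j (ℕP.+-monoˡ-< r (ℕP.≰⇒> j≰m))))) ⟩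
    + D (m ℕ.+ r ∸ j)                               ≡⟨ sym (E-≥ j≤m+r) ⟩
    E N r (+ (m ℕ.+ r)) j                           ∎
    where open ≡-Reasoning
  ... | no j≰m | no j≰m+r = begin
    F N r (+ (m ℕ.+ r) ℤ.- + N) j ℤ.+ E N r (+ m) j ≡⟨ cong₂ ℤ._+_ (F-> m+r<j) (E-< (ℕP.≰⇒> j≰m)) ⟩
    + χ (j ∸ (m ℕ.+ r)) ℤ.+ + 0                     ≡⟨ ℤP.+-identityʳ _ ⟩
    + χ (j ∸ (m ℕ.+ r))                             ≡⟨ cong +_ (trans (χ-below small) (ind-≢ (ℕP.m>n⇒m∸n≢0 m+r<j))) ⟩
    + 0                                             ≡⟨ sym (E-< m+r<j) ⟩
    E N r (+ (m ℕ.+ r)) j                           ∎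
    where
    open ≡-Reasoning
    m+r<j : m ℕ.+ r < j
    m+r<j = ℕP.≰⇒> j≰m+r
    small : j ∸ (m ℕ.+ r) < N ∸ r
    small = ℕP.m<n+o⇒m∸n<o j (m ℕ.+ r) (ℕP.≤-<-trans j≤N (subst (_< m ℕ.+ r ℕ.+ (N ∸ r)) r+[N∸r]≡N
              (ℕP.+-monoˡ-< (N ∸ r) (subst (r <_) (ℕP.+-comm r m) (ℕP.m<m+n r 1≤m)))))

  E-difference : ∀ {m j} → 1 ≤ m → j ≤ N → - E N r (+ m) j ℤ.+ E N r (+ (m ℕ.+ r)) j ≡ F N r (+ (m ℕ.+ N) ℤ.- + N) j
  E-difference {m} {j} 1≤m j≤N = begin
    - E N r (+ m) j ℤ.+ E N r (+ (m ℕ.+ r)) j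
      ≡⟨ cong (λ e → - E N r (+ m) j ℤ.+ e) (sym (E-step 1≤m j≤N)) ⟩
    - E N r (+ m) j ℤ.+ (F N r (+ (m ℕ.+ r) ℤ.- + N) j ℤ.+ E N r (+ m) j)
      ≡⟨ cancel (E N r (+ m) j) _ ⟩
    F N r (+ (m ℕ.+ r) ℤ.- + N) j
      ≡⟨ sym (F-period (+ (m ℕ.+ r) ℤ.- + N) j) ⟩
    F N r (+ (m ℕ.+ r) ℤ.- + N ℤ.+ + (N ∸ r)) j
      ≡⟨ cong (λ z → F N r z j) (trans (regroup (+ (m ℕ.+ r)) (+ N) (+ (N ∸ r))) (cong (ℤ._- + N) m+r+[N∸r]≡m+N)) ⟩
    F N r (+ (m ℕ.+ N) ℤ.- + N) j ∎
    where
    open ≡-Reasoning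
    cancel : ∀ a b → - a ℤ.+ (b ℤ.+ a) ≡ b
    cancel = solve-∀
    regroup : ∀ a n c → a ℤ.- n ℤ.+ c ≡ a ℤ.+ c ℤ.- n
    regroup = solve-∀
    m+r+[N∸r]≡m+N : + (m ℕ.+ r) ℤ.+ + (N ∸ r) ≡ + (m ℕ.+ N)
    m+r+[N∸r]≡m+N = trans (sym (ℤP.pos-+ (m ℕ.+ r) (N ∸ r))) (cong +_ (trans (ℕP.+-assoc m r (N ∸ r)) (cong (m ℕ.+_) r+[N∸r]≡N)))

  unit-step : ∀ {m j} → 1 ≤ m → m ≤ r → 1 ≤ j → j ≤ N →
              + ind (j ≡ᵇ m ℕ.+ (N ∸ r)) ℤ.+ E N r (+ m) j ≡ F N r (+ (m ℕ.+ (N ∸ r)) ℤ.- + N) j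
  unit-step {m} {j} 1≤m m≤r 1≤j j≤N with j ℕP.≤? m | j ℕP.≤? m ℕ.+ (N ∸ r)
  ... | yes j≤m | _ = begin
    + ind (j ≡ᵇ m ℕ.+ (N ∸ r)) ℤ.+ E N r (+ m) j
      ≡⟨ cong₂ ℤ._+_ (cong +_ (ind-≢ (ℕP.<⇒≢ (ℕP.≤-<-trans j≤m (ℕP.m<m+n m 1≤N∸r))))) (E-≥ j≤m) ⟩
    + D (m ∸ j)                       ≡⟨ cong +_ (D-below (∸-below m≤r 1≤j)) ⟩
    + χ (m ∸ j)                       ≡⟨ cong +_ (sym (χ-period (m ∸ j))) ⟩
    + χ (m ∸ j ℕ.+ (N ∸ r))           ≡⟨ cong (λ y → + χ y) (sym (ℕP.+-∸-comm (N ∸ r) j≤m)) ⟩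
    + χ (m ℕ.+ (N ∸ r) ∸ j)           ≡⟨ sym (F-≤ (ℕP.≤-trans j≤m (ℕP.m≤m+n m (N ∸ r)))) ⟩
    F N r (+ (m ℕ.+ (N ∸ r)) ℤ.- + N) j ∎
    where open ≡-Reasoning
  ... | no j≰m | yes j≤c = begin
    + ind (j ≡ᵇ m ℕ.+ (N ∸ r)) ℤ.+ E N r (+ m) j ≡⟨ cong (λ z → + ind (j ≡ᵇ m ℕ.+ (N ∸ r)) ℤ.+ z) (E-< (ℕP.≰⇒> j≰m)) ⟩
    + ind (j ≡ᵇ m ℕ.+ (N ∸ r)) ℤ.+ + 0           ≡⟨ ℤP.+-identityʳ _ ⟩
    + ind (j ≡ᵇ m ℕ.+ (N ∸ r))                   ≡⟨ cong +_ (trans (ind-sym j _) (sym (ind-∸-zero j≤c))) ⟩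
    + ind (m ℕ.+ (N ∸ r) ∸ j ≡ᵇ 0)
      ≡⟨ cong +_ (sym (χ-below (ℕP.m<n+o⇒m∸n<o (m ℕ.+ (N ∸ r)) j (ℕP.+-monoˡ-< (N ∸ r) (ℕP.≰⇒> j≰m))))) ⟩
    + χ (m ℕ.+ (N ∸ r) ∸ j)                      ≡⟨ sym (F-≤ j≤c) ⟩
    F N r (+ (m ℕ.+ (N ∸ r)) ℤ.- + N) j          ∎
    where open ≡-Reasoning
  ... | no j≰m | no j≰c = begin
    + ind (j ≡ᵇ m ℕ.+ (N ∸ r)) ℤ.+ E N r (+ m) j ≡⟨ cong₂ ℤ._+_ (cong +_ (ind-≢ (ℕP.>⇒≢ c<j))) (E-< (ℕP.≰⇒> j≰m)) ⟩
    + 0                                          ≡⟨ cong +_ (sym (trans (χ-below small) (ind-≢ (ℕP.m>n⇒m∸n≢0 c<j)))) ⟩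
    + χ (j ∸ (m ℕ.+ (N ∸ r)))                    ≡⟨ sym (F-> c<j) ⟩
    F N r (+ (m ℕ.+ (N ∸ r)) ℤ.- + N) j          ∎
    where
    open ≡-Reasoning
    c<j : m ℕ.+ (N ∸ r) < j
    c<j = ℕP.≰⇒> j≰c
    small : j ∸ (m ℕ.+ (N ∸ r)) < N ∸ r
    small = ℕP.m<n+o⇒m∸n<o j (m ℕ.+ (N ∸ r)) (ℕP.≤-<-trans j≤N (subst (_< m ℕ.+ (N ∸ r) ℕ.+ (N ∸ r)) r+[N∸r]≡N
              (ℕP.+-monoˡ-< (N ∸ r) (ℕP.<-≤-trans r<N∸r (ℕP.m≤n+m (N ∸ r) m)))))

  -- The c-vectors in closed form

  -- c_i^{(ℓ)} for i at position p, with L = ℓ + p, by the zone p ≤ r, r < p ≤ N − r or N − r < p;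
  -- in the last zone it is still the unit vector e_L while L ≤ N, which can only happen for ℓ < r
  c-formula : Bool → Bool → ℕ → ℕ → ℤ
  c-formula low mid L j =
    if low then E N r (+ L) j
    else if mid then F N r (+ L ℤ.- + N) j
    else if N <ᵇ L then - E N r (+ L ℤ.- + N) j
    else + ind (j ≡ᵇ L)

  c-closed : ℕ → ℕ → ℕ → ℤ
  c-closed ℓ p = c-formula (p ≤ᵇ r) (p ≤ᵇ N ∸ r) (ℓ ℕ.+ p)

  c-closed-low : ∀ {ℓ p j} → p ≤ r → c-closed ℓ p j ≡ E N r (+ (ℓ ℕ.+ p)) j
  c-closed-low {p = p} p≤r rewrite dec-true (p ℕP.≤? r) p≤r = refl

  c-closed-mid : ∀ {ℓ p j} → r < p → p ≤ N ∸ r → c-closed ℓ p j ≡ F N r (+ (ℓ ℕ.+ p) ℤ.- + N) j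
  c-closed-mid {p = p} r<p p≤N∸r rewrite dec-false (p ℕP.≤? r) (ℕP.<⇒≱ r<p) | dec-true (p ℕP.≤? N ∸ r) p≤N∸r = refl

  c-closed-high : ∀ {ℓ p j} → N ∸ r < p → N < ℓ ℕ.+ p → c-closed ℓ p j ≡ - E N r (+ (ℓ ℕ.+ p) ℤ.- + N) j
  c-closed-high {ℓ} {p} N∸r<p N<ℓ+p
    rewrite dec-false (p ℕP.≤? r) (ℕP.<⇒≱ (ℕP.<-trans r<N∸r N∸r<p)) | dec-false (p ℕP.≤? N ∸ r) (ℕP.<⇒≱ N∸r<p)
          | dec-true (N ℕP.<? ℓ ℕ.+ p) N<ℓ+p = refl

  c-closed-fresh : ∀ {ℓ p j} → N ∸ r < p → ℓ ℕ.+ p ≤ N → c-closed ℓ p j ≡ + ind (j ≡ᵇ ℓ ℕ.+ p)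
  c-closed-fresh {ℓ} {p} N∸r<p ℓ+p≤N
    rewrite dec-false (p ℕP.≤? r) (ℕP.<⇒≱ (ℕP.<-trans r<N∸r N∸r<p)) | dec-false (p ℕP.≤? N ∸ r) (ℕP.<⇒≱ N∸r<p)
          | dec-false (N ℕP.<? ℓ ℕ.+ p) (ℕP.≤⇒≯ ℓ+p≤N) = refl

  c-closed-initial : ∀ {p j} → InRange p → InRange j → c-closed 0 p j ≡ + ind (p ≡ᵇ j)
  c-closed-initial {p} {j} (1≤p , p≤N) (1≤j , j≤N) with p ℕP.≤? r | p ℕP.≤? N ∸ r | j ℕP.≤? p
  ... | yes p≤r | _ | yes j≤p = begin
    c-closed 0 p j           ≡⟨ c-closed-low p≤r ⟩
    E N r (+ p) j            ≡⟨ E-≥ j≤p ⟩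
    + D (p ∸ j)              ≡⟨ cong +_ (D-below p∸j<r) ⟩
    + χ (p ∸ j)              ≡⟨ cong +_ (χ-below (ℕP.<-trans p∸j<r r<N∸r)) ⟩
    + ind (p ∸ j ≡ᵇ 0)       ≡⟨ cong +_ (ind-∸-zero j≤p) ⟩
    + ind (p ≡ᵇ j)           ∎
    where
    open ≡-Reasoning
    p∸j<r : p ∸ j < r
    p∸j<r = ∸-below p≤r 1≤j
  ... | yes p≤r | _ | no j≰p =
    trans (c-closed-low p≤r) (trans (E-< (ℕP.≰⇒> j≰p)) (cong +_ (sym (ind-≢ (ℕP.<⇒≢ (ℕP.≰⇒> j≰p))))))
  ... | no p≰r | yes p≤N∸r | yes j≤p = begin
    c-closed 0 p j           ≡⟨ c-closed-mid (ℕP.≰⇒> p≰r) p≤N∸r ⟩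
    F N r (+ p ℤ.- + N) j    ≡⟨ F-≤ j≤p ⟩
    + χ (p ∸ j)              ≡⟨ cong +_ (χ-below (∸-below p≤N∸r 1≤j)) ⟩
    + ind (p ∸ j ≡ᵇ 0)       ≡⟨ cong +_ (ind-∸-zero j≤p) ⟩
    + ind (p ≡ᵇ j)           ∎
    where open ≡-Reasoning
  ... | no p≰r | yes p≤N∸r | no j≰p = begin
    c-closed 0 p j           ≡⟨ c-closed-mid (ℕP.≰⇒> p≰r) p≤N∸r ⟩
    F N r (+ p ℤ.- + N) j    ≡⟨ F-> p<j ⟩
    + χ (j ∸ p)              ≡⟨ cong +_ (trans (χ-below j∸p<N∸r) (ind-≢ (ℕP.m>n⇒m∸n≢0 p<j))) ⟩
    + 0                      ≡⟨ cong +_ (sym (ind-≢ (ℕP.<⇒≢ p<j))) ⟩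
    + ind (p ≡ᵇ j)           ∎
    where
    open ≡-Reasoning
    p<j : p < j
    p<j = ℕP.≰⇒> j≰p
    j∸p<N∸r : j ∸ p < N ∸ r
    j∸p<N∸r = ℕP.m<n+o⇒m∸n<o j p (ℕP.≤-<-trans j≤N (subst (_< p ℕ.+ (N ∸ r)) r+[N∸r]≡N (ℕP.+-monoˡ-< (N ∸ r) (ℕP.≰⇒> p≰r))))
  ... | no p≰r | no p≰N∸r | _ = trans (c-closed-fresh (ℕP.≰⇒> p≰N∸r) p≤N) (cong +_ (ind-sym j p))

  c-closed-same-zone : ∀ ℓ q j → (suc q ≤ᵇ r) ≡ (q ≤ᵇ r) → (suc q ≤ᵇ N ∸ r) ≡ (q ≤ᵇ N ∸ r) →
                       c-closed ℓ (suc q) j ≡ c-closed (suc ℓ) q j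
  c-closed-same-zone ℓ q j low mid = cong₂ (λ (zone : Bool × Bool) L → c-formula (proj₁ zone) (proj₂ zone) L j)
                                            (cong₂ _,_ low mid) (ℕP.+-suc ℓ q)

  c-closed-no-crossing : ∀ ℓ {q j} → q ≢ r → q ≢ N ∸ r → (suc q ≤ᵇ r) ≡ (q ≤ᵇ r) → (suc q ≤ᵇ N ∸ r) ≡ (q ≤ᵇ N ∸ r) →
                         c-closed ℓ (suc q) j ℤ.+ E N r (+ (ℓ ℕ.+ 1)) j ℤ.* + out₁ (suc q) ≡ c-closed (suc ℓ) q j
  c-closed-no-crossing ℓ {q} {j} q≢r q≢N∸r low mid = begin
    c-closed ℓ (suc q) j ℤ.+ E N r (+ (ℓ ℕ.+ 1)) j ℤ.* + out₁ (suc q)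
      ≡⟨ cong (λ o → c-closed ℓ (suc q) j ℤ.+ E N r (+ (ℓ ℕ.+ 1)) j ℤ.* + o) (out₁-vanishes q≢r q≢N∸r) ⟩
    c-closed ℓ (suc q) j ℤ.+ E N r (+ (ℓ ℕ.+ 1)) j ℤ.* + 0
      ≡⟨ cong (λ z → c-closed ℓ (suc q) j ℤ.+ z) (ℤP.*-zeroʳ (E N r (+ (ℓ ℕ.+ 1)) j)) ⟩
    c-closed ℓ (suc q) j ℤ.+ + 0
      ≡⟨ ℤP.+-identityʳ _ ⟩
    c-closed ℓ (suc q) j
      ≡⟨ c-closed-same-zone ℓ q j low mid ⟩
    c-closed (suc ℓ) q j ∎
    where open ≡-Reasoning

  c-closed-cross-r : ∀ ℓ {j} → j ≤ N → c-closed ℓ (suc r) j ℤ.+ E N r (+ (ℓ ℕ.+ 1)) j ≡ c-closed (suc ℓ) r j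
  c-closed-cross-r ℓ {j} j≤N = begin
    c-closed ℓ (suc r) j ℤ.+ E N r (+ (ℓ ℕ.+ 1)) j
      ≡⟨ cong₂ ℤ._+_ (c-closed-mid ℕP.≤-refl r<N∸r) (cong (λ m → E N r (+ m) j) (ℕP.+-comm ℓ 1)) ⟩
    F N r (+ (ℓ ℕ.+ suc r) ℤ.- + N) j ℤ.+ E N r (+ suc ℓ) j
      ≡⟨ cong (λ L → F N r (+ L ℤ.- + N) j ℤ.+ E N r (+ suc ℓ) j) (ℕP.+-suc ℓ r) ⟩
    F N r (+ (suc ℓ ℕ.+ r) ℤ.- + N) j ℤ.+ E N r (+ suc ℓ) j
      ≡⟨ E-step (s≤s z≤n) j≤N ⟩
    E N r (+ (suc ℓ ℕ.+ r)) j
      ≡⟨ sym (c-closed-low ℕP.≤-refl) ⟩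
    c-closed (suc ℓ) r j ∎
    where open ≡-Reasoning

  c-closed-cross-N∸r : ∀ ℓ {j} → 1 ≤ j → j ≤ N → c-closed ℓ (suc (N ∸ r)) j ℤ.+ E N r (+ (ℓ ℕ.+ 1)) j ≡ c-closed (suc ℓ) (N ∸ r) j
  c-closed-cross-N∸r ℓ {j} 1≤j j≤N = trans (from-high (N ℕP.<? L)) (sym (c-closed-mid r<N∸r ℕP.≤-refl))
    where
    L : ℕ
    L = ℓ ℕ.+ suc (N ∸ r)
    L≡ : L ≡ suc ℓ ℕ.+ (N ∸ r)
    L≡ = ℕP.+-suc ℓ (N ∸ r)
    from-high : Dec (N < L) → c-closed ℓ (suc (N ∸ r)) j ℤ.+ E N r (+ (ℓ ℕ.+ 1)) j ≡ F N r (+ (suc ℓ ℕ.+ (N ∸ r)) ℤ.- + N) j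
    from-high (yes N<L) = begin
      c-closed ℓ (suc (N ∸ r)) j ℤ.+ E N r (+ (ℓ ℕ.+ 1)) j
        ≡⟨ cong₂ ℤ._+_ (c-closed-high ℕP.≤-refl N<L) (cong (λ x → E N r (+ x) j) (sym m+r≡ℓ+1)) ⟩
      - E N r (+ L ℤ.- + N) j ℤ.+ E N r (+ (m ℕ.+ r)) j
        ≡⟨ cong (λ x → - E N r x j ℤ.+ E N r (+ (m ℕ.+ r)) j) (trans (ℤP.[+m]-[+n]≡m⊖n L N) (ℤP.⊖-≥ (ℕP.<⇒≤ N<L))) ⟩
      - E N r (+ m) j ℤ.+ E N r (+ (m ℕ.+ r)) j
        ≡⟨ E-difference (ℕP.m<n⇒0<n∸m N<L) j≤N ⟩
      F N r (+ (m ℕ.+ N) ℤ.- + N) j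
        ≡⟨ cong (λ x → F N r (+ x ℤ.- + N) j) (trans m+N≡L L≡) ⟩
      F N r (+ (suc ℓ ℕ.+ (N ∸ r)) ℤ.- + N) j ∎
      where
      open ≡-Reasoning
      m : ℕ
      m = L ∸ N
      m+N≡L : m ℕ.+ N ≡ L
      m+N≡L = ℕP.m∸n+n≡m (ℕP.<⇒≤ N<L)
      m+r≡ℓ+1 : m ℕ.+ r ≡ ℓ ℕ.+ 1
      m+r≡ℓ+1 = ℕP.+-cancelʳ-≡ (N ∸ r) _ _ (begin
        m ℕ.+ r ℕ.+ (N ∸ r)    ≡⟨ ℕP.+-assoc m r (N ∸ r) ⟩
        m ℕ.+ (r ℕ.+ (N ∸ r))  ≡⟨ cong (m ℕ.+_) r+[N∸r]≡N ⟩
        m ℕ.+ N                ≡⟨ trans m+N≡L L≡ ⟩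
        suc ℓ ℕ.+ (N ∸ r)      ≡⟨ cong (ℕ._+ (N ∸ r)) (ℕP.+-comm 1 ℓ) ⟩
        ℓ ℕ.+ 1 ℕ.+ (N ∸ r)    ∎)
    from-high (no N≮L) = begin
      c-closed ℓ (suc (N ∸ r)) j ℤ.+ E N r (+ (ℓ ℕ.+ 1)) j
        ≡⟨ cong₂ ℤ._+_ (c-closed-fresh ℕP.≤-refl (ℕP.≮⇒≥ N≮L)) (cong (λ x → E N r (+ x) j) (ℕP.+-comm ℓ 1)) ⟩
      + ind (j ≡ᵇ L) ℤ.+ E N r (+ suc ℓ) j
        ≡⟨ cong (λ x → + ind (j ≡ᵇ x) ℤ.+ E N r (+ suc ℓ) j) L≡ ⟩
      + ind (j ≡ᵇ suc ℓ ℕ.+ (N ∸ r)) ℤ.+ E N r (+ suc ℓ) j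
        ≡⟨ unit-step (s≤s z≤n) 1+ℓ≤r 1≤j j≤N ⟩
      F N r (+ (suc ℓ ℕ.+ (N ∸ r)) ℤ.- + N) j ∎
      where
      open ≡-Reasoning
      1+ℓ≤r : suc ℓ ≤ r
      1+ℓ≤r = ℕP.+-cancelʳ-≤ (N ∸ r) (suc ℓ) r (subst₂ _≤_ L≡ (sym r+[N∸r]≡N) (ℕP.≮⇒≥ N≮L))

  c-closed-shift : ∀ ℓ {q j} → 1 ≤ q → suc q ≤ N → 1 ≤ j → j ≤ N →
                   c-closed ℓ (suc q) j ℤ.+ E N r (+ (ℓ ℕ.+ 1)) j ℤ.* + out₁ (suc q) ≡ c-closed (suc ℓ) q j
  c-closed-shift ℓ {q} {j} 1≤q q<N 1≤j j≤N with ℕP.<-cmp q r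
  ... | tri< q<r _ _ = c-closed-no-crossing ℓ (ℕP.<⇒≢ q<r) (ℕP.<⇒≢ q<N∸r)
                         (both-true (ℕP.≤⇒≤ᵇ q<r) (ℕP.≤⇒≤ᵇ (ℕP.<⇒≤ q<r)))
                         (both-true (ℕP.≤⇒≤ᵇ q<N∸r) (ℕP.≤⇒≤ᵇ (ℕP.<⇒≤ q<N∸r)))
    where q<N∸r : q < N ∸ r
          q<N∸r = ℕP.<-trans q<r r<N∸r
  ... | tri≈ _ refl _ = trans (cong (λ o → c-closed ℓ (suc r) j ℤ.+ E N r (+ (ℓ ℕ.+ 1)) j ℤ.* + o) out₁-r)
                              (trans (cong (λ z → c-closed ℓ (suc r) j ℤ.+ z) (ℤP.*-identityʳ _)) (c-closed-cross-r ℓ j≤N))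
  ... | tri> _ _ r<q with ℕP.<-cmp q (N ∸ r)
  ...   | tri< q<N∸r _ _ = c-closed-no-crossing ℓ (ℕP.>⇒≢ r<q) (ℕP.<⇒≢ q<N∸r)
                             (both-false (ℕP.<⇒≱ (ℕP.<-trans r<q ℕP.≤-refl) ∘ ℕP.≤ᵇ⇒≤ (suc q) r) (ℕP.<⇒≱ r<q ∘ ℕP.≤ᵇ⇒≤ q r))
                             (both-true (ℕP.≤⇒≤ᵇ q<N∸r) (ℕP.≤⇒≤ᵇ (ℕP.<⇒≤ q<N∸r)))
  ...   | tri≈ _ refl _ = trans (cong (λ o → c-closed ℓ (suc (N ∸ r)) j ℤ.+ E N r (+ (ℓ ℕ.+ 1)) j ℤ.* + o) out₁-N∸r)
                                (trans (cong (λ z → c-closed ℓ (suc (N ∸ r)) j ℤ.+ z) (ℤP.*-identityʳ _)) (c-closed-cross-N∸r ℓ 1≤j j≤N))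
  ...   | tri> _ _ N∸r<q = c-closed-no-crossing ℓ (ℕP.>⇒≢ r<q) (ℕP.>⇒≢ N∸r<q)
                             (both-false (ℕP.<⇒≱ (ℕP.<-trans r<q ℕP.≤-refl) ∘ ℕP.≤ᵇ⇒≤ (suc q) r) (ℕP.<⇒≱ r<q ∘ ℕP.≤ᵇ⇒≤ q r))
                             (both-false (ℕP.<⇒≱ (ℕP.<-trans N∸r<q ℕP.≤-refl) ∘ ℕP.≤ᵇ⇒≤ (suc q) _)
                                         (ℕP.<⇒≱ N∸r<q ∘ ℕP.≤ᵇ⇒≤ q _))

  c-closed-wrap : ∀ ℓ {j} → c-closed (suc ℓ) N j ≡ - c-closed ℓ 1 j
  c-closed-wrap ℓ {j} = begin
    c-closed (suc ℓ) N j                 ≡⟨ c-closed-high N∸r<N (ℕP.m<n+m N (s≤s z≤n)) ⟩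
    - E N r (+ (suc ℓ ℕ.+ N) ℤ.- + N) j
      ≡⟨ cong (λ z → - E N r z j) (trans (ℤP.[+m]-[+n]≡m⊖n (suc ℓ ℕ.+ N) N) (ℤP.⊖-≥ (ℕP.m≤n+m N (suc ℓ)))) ⟩
    - E N r (+ (suc ℓ ℕ.+ N ∸ N)) j      ≡⟨ cong (λ m → - E N r (+ m) j) (trans (ℕP.m+n∸n≡m (suc ℓ) N) (ℕP.+-comm 1 ℓ)) ⟩
    - E N r (+ (ℓ ℕ.+ 1)) j              ≡⟨ cong -_ (sym (c-closed-low 1≤r)) ⟩
    - c-closed ℓ 1 j                     ∎
    where open ≡-Reasoning

  c-closed-step : ∀ ℓ {p j} → InRange p → 1 ≤ j → j ≤ N →
                  (if p ≡ᵇ 1 then - c-closed ℓ p j else c-closed ℓ p j ℤ.+ E N r (+ (ℓ ℕ.+ 1)) j ℤ.* pos (β 1 p))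
                  ≡ c-closed (suc ℓ) (rot p) j
  c-closed-step ℓ {suc zero}    _         _   _   = sym (c-closed-wrap ℓ)
  c-closed-step ℓ {suc (suc q)} {j} (_ , p≤N) 1≤j j≤N =
    trans (cong (λ e → c-closed ℓ (2 ℕ.+ q) j ℤ.+ E N r (+ (ℓ ℕ.+ 1)) j ℤ.* e) (pos-β-from-1 q))
          (c-closed-shift ℓ (s≤s z≤n) p≤N 1≤j j≤N)

  cvec-closed : ∀ ℓ {i j} → InRange i → InRange j → cvec N r s ℓ i j ≡ c-closed ℓ (position ℓ i) j
  cvec-closed zero    i∈ j∈ = trans (cvec-initial i∈ j∈) (sym (c-closed-initial i∈ j∈))
  cvec-closed (suc ℓ) {i} {j} i∈ j∈@(1≤j , j≤N) = begin
    mutate k B (N ℕ.+ j) i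
      ≡⟨ c-mutation k B i _ (periodicB-skew N r s ℓ) (ℕP.>⇒≢ (ℕP.≤-<-trans (proj₂ k∈) (ℕP.m<m+n N 1≤j))) ck≡Eℓ+1 ⟩
    (if i ≡ᵇ k then - B (N ℕ.+ j) i else B (N ℕ.+ j) i ℤ.+ E N r (+ (ℓ ℕ.+ 1)) j ℤ.* pos (B k i))
      ≡⟨ cong (λ b → if b then - B (N ℕ.+ j) i else B (N ℕ.+ j) i ℤ.+ E N r (+ (ℓ ℕ.+ 1)) j ℤ.* pos (B k i))
              (trans (is-mutated ℓ i∈) (cong (p ≡ᵇ_) (position-mutated ℓ))) ⟩
    (if p ≡ᵇ 1 then - B (N ℕ.+ j) i else B (N ℕ.+ j) i ℤ.+ E N r (+ (ℓ ℕ.+ 1)) j ℤ.* pos (B k i))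
      ≡⟨ cong₂ (λ c e → if p ≡ᵇ 1 then - c else c ℤ.+ E N r (+ (ℓ ℕ.+ 1)) j ℤ.* pos e)
               (cvec-closed ℓ i∈ j∈) (trans (periodic-quiver ℓ k∈ i∈) (cong (λ x → β x p) (position-mutated ℓ))) ⟩
    (if p ≡ᵇ 1 then - c-closed ℓ p j else c-closed ℓ p j ℤ.+ E N r (+ (ℓ ℕ.+ 1)) j ℤ.* pos (β 1 p))
      ≡⟨ c-closed-step ℓ (position-range ℓ i∈) 1≤j j≤N ⟩
    c-closed (suc ℓ) (position (suc ℓ) i) j ∎
    where
    open ≡-Reasoning
    k p : ℕ
    k = mutated ℓ
    p = position ℓ i
    k∈ : InRange k
    k∈ = mutated-range ℓ
    B : Mat
    B = periodicB N r s ℓ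
    ck≡Eℓ+1 : B (N ℕ.+ j) k ≡ E N r (+ (ℓ ℕ.+ 1)) j
    ck≡Eℓ+1 = trans (cvec-closed ℓ k∈ j∈) (trans (cong (λ x → c-closed ℓ x j) (position-mutated ℓ)) (c-closed-low 1≤r))

  -- The label ⌊(ℓ + r − i)/N⌋N + i

  data Zone (p : ℕ) : Set where
    low  : p ≤ r → Zone p
    mid  : r < p → p ≤ N ∸ r → Zone p
    high : N ∸ r < p → Zone p

  zone : ∀ p → Zone p
  zone p with p ℕP.≤? r | p ℕP.≤? N ∸ r
  ... | yes p≤r | _          = low p≤r
  ... | no p≰r  | yes p≤N∸r = mid (ℕP.≰⇒> p≰r) p≤N∸r
  ... | no _    | no p≰N∸r  = high (ℕP.≰⇒> p≰N∸r)

  module _ (ℓ : ℕ) {i : ℕ} (i∈ : InRange i) where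

    private
      p Q : ℕ
      p = position ℓ i
      Q = proj₁ (position-congruent ℓ i∈)
      u : ℤ
      u = under N r ℓ i
      1≤p : 1 ≤ p
      1≤p = proj₁ (position-range ℓ i∈)
      p≤N : p ≤ N
      p≤N = proj₂ (position-range ℓ i∈)

      ℓ+p≡i+QN : + (ℓ ℕ.+ p) ≡ + i ℤ.+ + Q ℤ.* + N
      ℓ+p≡i+QN = begin
        + (ℓ ℕ.+ p)        ≡⟨ cong +_ (proj₂ (position-congruent ℓ i∈)) ⟩
        + (Q * N ℕ.+ i)    ≡⟨ ℤP.pos-+ (Q * N) i ⟩
        + (Q * N) ℤ.+ + i  ≡⟨ cong (ℤ._+ + i) (ℤP.pos-* Q N) ⟩
        + Q ℤ.* + N ℤ.+ + i ≡⟨ ℤP.+-comm (+ Q ℤ.* + N) (+ i) ⟩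
        + i ℤ.+ + Q ℤ.* + N ∎
        where open ≡-Reasoning

    under-low : p ≤ r → u ≡ + (ℓ ℕ.+ p)
    under-low p≤r = trans (floor-window N (+ (ℓ ℕ.+ r)) (+ i) (+ Q) lower upper) (sym ℓ+p≡i+QN)
      where
      lower : + (ℓ ℕ.+ r) ℤ.- + N ℤ.< + i ℤ.+ + Q ℤ.* + N
      lower = subst (+ (ℓ ℕ.+ r) ℤ.- + N ℤ.<_) (trans (ℤP.+-identityʳ _) ℓ+p≡i+QN)
                    (diff-< {ℓ ℕ.+ r} {N} {ℓ ℕ.+ p} {0} (subst₂ _<_ (sym (ℕP.+-identityʳ (ℓ ℕ.+ r))) (sym (ℕP.+-assoc ℓ p N))
                                         (ℕP.+-monoʳ-< ℓ (ℕP.<-≤-trans r<N (ℕP.m≤n+m N p)))))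
      upper : + i ℤ.+ + Q ℤ.* + N ℤ.≤ + (ℓ ℕ.+ r)
      upper = subst (ℤ._≤ + (ℓ ℕ.+ r)) ℓ+p≡i+QN (ℤ.+≤+ (ℕP.+-monoʳ-≤ ℓ p≤r))

    under-high : r < p → u ≡ + (ℓ ℕ.+ p) ℤ.- + N
    under-high r<p = trans (floor-window N (+ (ℓ ℕ.+ r)) (+ i) (+ Q ℤ.- + 1) lower upper) shifted
      where
      shifted : + i ℤ.+ (+ Q ℤ.- + 1) ℤ.* + N ≡ + (ℓ ℕ.+ p) ℤ.- + N
      shifted = trans (regroup (+ i) (+ Q) (+ N)) (cong (ℤ._- + N) (sym ℓ+p≡i+QN))
        where regroup : ∀ x q n → x ℤ.+ (q ℤ.- + 1) ℤ.* n ≡ x ℤ.+ q ℤ.* n ℤ.- n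
              regroup = solve-∀
      lower : + (ℓ ℕ.+ r) ℤ.- + N ℤ.< + i ℤ.+ (+ Q ℤ.- + 1) ℤ.* + N
      lower = subst (+ (ℓ ℕ.+ r) ℤ.- + N ℤ.<_) (sym shifted)
                    (diff-< {ℓ ℕ.+ r} {N} {ℓ ℕ.+ p} {N} (ℕP.+-monoˡ-< N (ℕP.+-monoʳ-< ℓ r<p)))
      upper : + i ℤ.+ (+ Q ℤ.- + 1) ℤ.* + N ℤ.≤ + (ℓ ℕ.+ r)
      upper = subst₂ ℤ._≤_ (sym shifted) (ℤP.+-identityʳ _)
                     (diff-≤ {ℓ ℕ.+ p} {N} {ℓ ℕ.+ r} {0} (subst₂ _≤_ (sym (ℕP.+-identityʳ (ℓ ℕ.+ p))) (sym (ℕP.+-assoc ℓ r N))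
                                                                   (ℕP.+-monoʳ-≤ ℓ (ℕP.≤-trans p≤N (ℕP.m≤n+m N r)))))

    low-zone : p ≤ r → + ℓ ℤ.+ + 1 ℤ.≤ u × u ℤ.≤ + ℓ ℤ.+ + r × (∀ {j} → InRange j → cvec N r s ℓ i j ≡ E N r u j)
    low-zone p≤r =
        subst₂ ℤ._≤_ (ℤP.pos-+ ℓ 1) (sym (under-low p≤r)) (ℤ.+≤+ (ℕP.+-monoʳ-≤ ℓ 1≤p))
      , subst₂ ℤ._≤_ (sym (under-low p≤r)) (ℤP.pos-+ ℓ r) (ℤ.+≤+ (ℕP.+-monoʳ-≤ ℓ p≤r))
      , λ j∈ → trans (cvec-closed ℓ i∈ j∈) (trans (c-closed-low p≤r) (cong (λ x → E N r x _) (sym (under-low p≤r))))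

    mid-zone : r < p → p ≤ N ∸ r → u ℤ.< + ℓ ℤ.+ + 1 ℤ.- + r × (∀ {j} → InRange j → cvec N r s ℓ i j ≡ F N r u j)
    mid-zone r<p p≤N∸r =
        subst₂ ℤ._<_ (sym (under-high r<p)) (cong (ℤ._- + r) (ℤP.pos-+ ℓ 1))
               (diff-< {ℓ ℕ.+ p} {N} {ℓ ℕ.+ 1} {r} (subst₂ _<_ (sym (ℕP.+-assoc ℓ p r)) (sym (ℕP.+-assoc ℓ 1 N))
                                                             (ℕP.+-monoʳ-< ℓ (s≤s p+r≤N))))
      , λ j∈ → trans (cvec-closed ℓ i∈ j∈) (trans (c-closed-mid r<p p≤N∸r) (cong (λ x → F N r x _) (sym (under-high r<p))))
      where p+r≤N : p ℕ.+ r ≤ N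
            p+r≤N = subst (p ℕ.+ r ≤_) (ℕP.m∸n+n≡m r≤N) (ℕP.+-monoˡ-≤ r p≤N∸r)

    high-zone : r ≤ ℓ → N ∸ r < p → + ℓ ℤ.+ + 1 ℤ.- + r ℤ.≤ u × u ℤ.≤ + ℓ × (∀ {j} → InRange j → cvec N r s ℓ i j ≡ - E N r u j)
    high-zone r≤ℓ N∸r<p =
        subst₂ ℤ._≤_ (cong (ℤ._- + r) (ℤP.pos-+ ℓ 1)) (sym (under-high r<p))
               (diff-≤ {ℓ ℕ.+ 1} {r} {ℓ ℕ.+ p} {N} (subst₂ _≤_ (sym (ℕP.+-assoc ℓ 1 N)) (sym (ℕP.+-assoc ℓ p r))
                                                             (ℕP.+-monoʳ-≤ ℓ N<p+r)))
      , subst₂ ℤ._≤_ (sym (under-high r<p)) (ℤP.+-identityʳ (+ ℓ))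
               (diff-≤ {ℓ ℕ.+ p} {N} {ℓ} {0} (subst₂ _≤_ (sym (ℕP.+-identityʳ (ℓ ℕ.+ p))) refl (ℕP.+-monoʳ-≤ ℓ p≤N)))
      , λ j∈ → trans (cvec-closed ℓ i∈ j∈) (trans (c-closed-high N∸r<p N<ℓ+p) (cong (λ x → - E N r x _) (sym (under-high r<p))))
      where
      r<p : r < p
      r<p = ℕP.<-trans r<N∸r N∸r<p
      N<p+r : N < p ℕ.+ r
      N<p+r = subst (_< p ℕ.+ r) (ℕP.m∸n+n≡m r≤N) (ℕP.+-monoˡ-< r N∸r<p)
      N<ℓ+p : N < ℓ ℕ.+ p
      N<ℓ+p = subst (_< ℓ ℕ.+ p) r+[N∸r]≡N (ℕP.+-mono-≤-< r≤ℓ N∸r<p)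

  c-vector-negative : ∀ ℓ → r ≤ ℓ → ∀ {i} → InRange i →
                      + ℓ ℤ.+ + 1 ℤ.- + r ℤ.≤ under N r ℓ i → under N r ℓ i ℤ.≤ + ℓ →
                      ∀ {j} → InRange j → cvec N r s ℓ i j ≡ - E N r (under N r ℓ i) j
  c-vector-negative ℓ r≤ℓ {i} i∈ lower upper with zone (position ℓ i)
  ... | low p≤r       = ⊥-elim (ℤP.<⇒≱ (pos<pos+1 ℓ) (ℤP.≤-trans (proj₁ (low-zone ℓ i∈ p≤r)) upper))
  ... | mid r<p p≤N∸r = ⊥-elim (ℤP.<⇒≱ (proj₁ (mid-zone ℓ i∈ r<p p≤N∸r)) lower)
  ... | high N∸r<p    = proj₂ (proj₂ (high-zone ℓ i∈ r≤ℓ N∸r<p))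

  c-vector-positive : ∀ ℓ → r ≤ ℓ → ∀ {i} → InRange i →
                      + ℓ ℤ.+ + 1 ℤ.≤ under N r ℓ i → under N r ℓ i ℤ.≤ + ℓ ℤ.+ + r →
                      ∀ {j} → InRange j → cvec N r s ℓ i j ≡ E N r (under N r ℓ i) j
  c-vector-positive ℓ r≤ℓ {i} i∈ lower upper with zone (position ℓ i)
  ... | low p≤r       = proj₂ (proj₂ (low-zone ℓ i∈ p≤r))
  ... | mid r<p p≤N∸r = ⊥-elim (ℤP.<⇒≱ (proj₁ (mid-zone ℓ i∈ r<p p≤N∸r)) (ℤP.≤-trans (ℤP.i-j≤i _ (+ r)) lower))
  ... | high N∸r<p    = ⊥-elim (ℤP.<⇒≱ (pos<pos+1 ℓ) (ℤP.≤-trans lower (proj₁ (proj₂ (high-zone ℓ i∈ r≤ℓ N∸r<p)))))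

  c-vector-middle : ∀ ℓ → r ≤ ℓ → ∀ {i} → InRange i →
                    ¬ (+ ℓ ℤ.+ + 1 ℤ.- + r ℤ.≤ under N r ℓ i × under N r ℓ i ℤ.≤ + ℓ ℤ.+ + r) →
                    ∀ {j} → InRange j → cvec N r s ℓ i j ≡ F N r (under N r ℓ i) j
  c-vector-middle ℓ r≤ℓ {i} i∈ outside with zone (position ℓ i)
  ... | low p≤r       = let lower , upper , _ = low-zone ℓ i∈ p≤r in
                        ⊥-elim (outside (ℤP.≤-trans (ℤP.i-j≤i _ (+ r)) lower , upper))
  ... | mid r<p p≤N∸r = proj₂ (mid-zone ℓ i∈ r<p p≤N∸r)
  ... | high N∸r<p    = let lower , upper , _ = high-zone ℓ i∈ r≤ℓ N∸r<p in
                        ⊥-elim (outside (lower , ℤP.≤-trans upper (ℤP.i≤i+j (+ ℓ) (+ r))))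

lemma5p1 : (N r s : ℕ) .{{_ : NonZero N}} → 1 ≤ r → r < s → 2 * s ≤ N →
             (ℓ : ℕ) → r ≤ ℓ → (i : ℕ) → 1 ≤ i → i ≤ N →
             ((+ ℓ ℤ.+ + 1 ℤ.- + r ℤ.≤ under N r ℓ i) → (under N r ℓ i ℤ.≤ + ℓ) →
                (j : ℕ) → 1 ≤ j → j ≤ N → cvec N r s ℓ i j ≡ - E N r (under N r ℓ i) j)
             × ((+ ℓ ℤ.+ + 1 ℤ.≤ under N r ℓ i) → (under N r ℓ i ℤ.≤ + ℓ ℤ.+ + r) →
                (j : ℕ) → 1 ≤ j → j ≤ N → cvec N r s ℓ i j ≡ E N r (under N r ℓ i) j)
             × (¬ ((+ ℓ ℤ.+ + 1 ℤ.- + r ℤ.≤ under N r ℓ i) × (under N r ℓ i ℤ.≤ + ℓ ℤ.+ + r)) →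
                (j : ℕ) → 1 ≤ j → j ≤ N → cvec N r s ℓ i j ≡ F N r (under N r ℓ i) j)
lemma5p1 N r s 1≤r r<s 2s≤N ℓ r≤ℓ i 1≤i i≤N =
    (λ lower upper j 1≤j j≤N → c-vector-negative ℓ r≤ℓ (1≤i , i≤N) lower upper (1≤j , j≤N))
  , (λ lower upper j 1≤j j≤N → c-vector-positive ℓ r≤ℓ (1≤i , i≤N) lower upper (1≤j , j≤N))
  , (λ outside j 1≤j j≤N → c-vector-middle ℓ r≤ℓ (1≤i , i≤N) outside (1≤j , j≤N))
  where open GaleRobinson N r s 1≤r r<s 2s≤N
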